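{- Let $\mathcal{C}$ be a compact dagger category and $(A,m,e)$ a monoid in $\mathcal{C}$. Define $i\colon A\to A^*$ by $i=(\mathrm{id}_{A^*}\otimes(e^\dagger\circ m))\circ(u_A\otimes\mathrm{id}_A)$ and $R\colon A\to A^*\otimes A$ by $R=(\mathrm{id}_{A^*}\otimes m)\circ(u_A\otimes\mathrm{id}_A)$ (modulo coherence isomorphisms). Then $(A,m,e)$ is a Frobenius monoid if and only if $i$ is an involution making $A$ an involutive monoid and $R$ is a homomorphism of involutive monoids from $(A,m,e,i)$ to $A^*\otimes A$ equipped with the pair-of-pants monoid structure and the identity involution.
   Context: A dagger category has an identity-on-objects involutive contravariant functor $f\mapsto f^\dagger$. A compact dagger category is a symmetric monoidal dagger category (dagger with $(f\otimes g)^\dagger=f^\dagger\otimes g^\dagger$ and unitary coherence isomorphisms and symmetries $\sigma$) in which each object $A$ has a chosen dual $A^*$ and $u_A\colon I\to A^*\otimes A$ such that with $c_A=u_A^\dagger\circ\sigma_{A,A^*}\colon A\otimes A^*\to I$ the snake identities $(c_A\otimes\mathrm{id}_A)\circ(\mathrm{id}_A\otimes u_A)=\mathrm{id}_A$ and $(\mathrm{id}_{A^*}\otimes c_A)\circ(u_A\otimes\mathrm{id}_{A^*})=\mathrm{id}_{A^*}$ hold; conventions $A^{**}=A$, $(A\otimes B)^*=B^*\otimes A^*$, $I^*=I$. For $f\colon A\to B$, $f_*\colon A^*\to B^*$ is the transpose of $f^\dagger$: $f_*=(\mathrm{id}_{B^*}\otimes c_A)\circ(\mathrm{id}_{B^*}\otimes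 f^\dagger\otimes\mathrm{id}_{A^*})\circ(u_B\otimes\mathrm{id}_{A^*})$. For a monoid $(A,m,e)$, $A^*$ is a monoid (the opposite monoid) with multiplication $m_*\colon A^*\otimes A^*\to A^*$ and unit $e_*$. A monoid homomorphism preserves multiplication and unit. A monoid $(A,m,e)$ is a Frobenius monoid if $(\mathrm{id}_A\otimes m)\circ(m^\dagger\otimes\mathrm{id}_A)=(m\otimes\mathrm{id}_A)\circ(\mathrm{id}_A\otimes m^\dagger)$ (modulo associators). An involutive monoid is a monoid $A$ together with a monoid homomorphism $i\colon A\to A^*$ (into the opposite monoid) with $i_*\circ i=\mathrm{id}_A$; a homomorphism of involutive monoids $(A,i)\to(B,j)$ is a monoid homomorphism $f$ with $j\circ f=f_*\circ i$. The pair-of-pants monoid on $A^*\otimes A$ has multiplication $\mathrm{id}_{A^*}\otimes c_A\otimes\mathrm{id}_A$ and unit $u_A$; since $(A^*\otimes A)^*=A^{**}\otimes A^*$... with the conventions $(A^*\otimes A)^*=A^*\otimes A$, and its involution is taken to be the identity. -}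

module Defs where

open import Level using (Level; _⊔_) renaming (suc to lsuc)
open import Relation.Binary using (Rel; IsEquivalence)
open import Relation.Binary.PropositionalEquality using (_≡_; refl; sym; trans; cong; subst)
open import Data.Product using (_×_; _,_)

record CompactDaggerCategory (o ℓ e : Level) : Set (lsuc (o ⊔ ℓ ⊔ e)) where
  infixr 9 _∘_
  infixr 10 _⊗₁_
  infixr 10 _⊗₀_
  infix 4 _≈_
  infix 15 _†
  infix 16 _*
  field
    Obj : Set o
    Hom : Obj → Obj → Set ℓ
    _≈_ : ∀ {A B} → Rel (Hom A B) e
    ≈-equiv : ∀ {A B} → IsEquivalence (_≈_ {A} {B})
    id : ∀ {A} → Hom A A
    _∘_ : ∀ {A B C} → Hom B C → Hom A B → Hom A C
    ∘-assoc : ∀ {A B C D} {f : Hom A B} {g : Hom B C} {h : Hom C D} →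
              (h ∘ g) ∘ f ≈ h ∘ (g ∘ f)
    identityˡ : ∀ {A B} {f : Hom A B} → id ∘ f ≈ f
    identityʳ : ∀ {A B} {f : Hom A B} → f ∘ id ≈ f
    ∘-resp-≈ : ∀ {A B C} {f f′ : Hom B C} {g g′ : Hom A B} →
               f ≈ f′ → g ≈ g′ → f ∘ g ≈ f′ ∘ g′

    _† : ∀ {A B} → Hom A B → Hom B A
    †-resp-≈ : ∀ {A B} {f g : Hom A B} → f ≈ g → f † ≈ g †
    †-identity : ∀ {A} → id {A} † ≈ id
    †-homomorphism : ∀ {A B C} {f : Hom A B} {g : Hom B C} → (g ∘ f) † ≈ f † ∘ g †
    †-involutive : ∀ {A B} {f : Hom A B} → f † † ≈ f

    _⊗₀_ : Obj → Obj → Obj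
    I : Obj
    _⊗₁_ : ∀ {A B C D} → Hom A B → Hom C D → Hom (A ⊗₀ C) (B ⊗₀ D)
    ⊗-identity : ∀ {A B} → id {A} ⊗₁ id {B} ≈ id
    ⊗-homomorphism : ∀ {A B C D E F} {f : Hom A B} {g : Hom B C} {h : Hom D E} {k : Hom E F} →
                     (g ∘ f) ⊗₁ (k ∘ h) ≈ (g ⊗₁ k) ∘ (f ⊗₁ h)
    ⊗-resp-≈ : ∀ {A B C D} {f f′ : Hom A B} {g g′ : Hom C D} →
               f ≈ f′ → g ≈ g′ → f ⊗₁ g ≈ f′ ⊗₁ g′
    ⊗-† : ∀ {A B C D} {f : Hom A B} {g : Hom C D} → (f ⊗₁ g) † ≈ f † ⊗₁ g †

    α⇒ : ∀ {A B C} → Hom ((A ⊗₀ B) ⊗₀ C) (A ⊗₀ (B ⊗₀ C))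
    λ⇒ : ∀ {A} → Hom (I ⊗₀ A) A
    ρ⇒ : ∀ {A} → Hom (A ⊗₀ I) A
    σ : ∀ {A B} → Hom (A ⊗₀ B) (B ⊗₀ A)

    α-unitaryˡ : ∀ {A B C} → α⇒ {A} {B} {C} † ∘ α⇒ ≈ id
    α-unitaryʳ : ∀ {A B C} → α⇒ {A} {B} {C} ∘ α⇒ † ≈ id
    λ-unitaryˡ : ∀ {A} → λ⇒ {A} † ∘ λ⇒ ≈ id
    λ-unitaryʳ : ∀ {A} → λ⇒ {A} ∘ λ⇒ † ≈ id
    ρ-unitaryˡ : ∀ {A} → ρ⇒ {A} † ∘ ρ⇒ ≈ id
    ρ-unitaryʳ : ∀ {A} → ρ⇒ {A} ∘ ρ⇒ † ≈ id
    σ-unitaryˡ : ∀ {A B} → σ {A} {B} † ∘ σ ≈ id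
    σ-unitaryʳ : ∀ {A B} → σ {A} {B} ∘ σ † ≈ id

    α-natural : ∀ {A B C D E F} {f : Hom A B} {g : Hom C D} {h : Hom E F} →
                α⇒ ∘ ((f ⊗₁ g) ⊗₁ h) ≈ (f ⊗₁ (g ⊗₁ h)) ∘ α⇒
    λ-natural : ∀ {A B} {f : Hom A B} → λ⇒ ∘ (id ⊗₁ f) ≈ f ∘ λ⇒
    ρ-natural : ∀ {A B} {f : Hom A B} → ρ⇒ ∘ (f ⊗₁ id) ≈ f ∘ ρ⇒
    σ-natural : ∀ {A B C D} {f : Hom A B} {g : Hom C D} →
                σ ∘ (f ⊗₁ g) ≈ (g ⊗₁ f) ∘ σ

    pentagon : ∀ {A B C D} →
               (id {A} ⊗₁ α⇒ {B} {C} {D}) ∘ α⇒ ∘ (α⇒ ⊗₁ id) ≈ α⇒ ∘ α⇒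
    triangle : ∀ {A B} → (id {A} ⊗₁ λ⇒ {B}) ∘ α⇒ ≈ ρ⇒ ⊗₁ id
    hexagon : ∀ {A B C} →
              (id {B} ⊗₁ σ {A} {C}) ∘ α⇒ ∘ (σ ⊗₁ id) ≈ α⇒ ∘ σ ∘ α⇒
    symmetry : ∀ {A B} → σ {B} {A} ∘ σ {A} {B} ≈ id

    -- compact structure: chosen duals and units u_A : I → A* ⊗ A,
    -- with counit c_A = u_A† ∘ σ_{A,A*} : A ⊗ A* → I
    _* : Obj → Obj
    u : ∀ A → Hom I (A * ⊗₀ A)
    snake₁ : ∀ {A} →
             λ⇒ ∘ (((u A † ∘ σ) ⊗₁ id {A}) ∘ (α⇒ † ∘ ((id {A} ⊗₁ u A) ∘ ρ⇒ †))) ≈ id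
    snake₂ : ∀ {A} →
             ρ⇒ ∘ ((id {A *} ⊗₁ (u A † ∘ σ)) ∘ (α⇒ ∘ ((u A ⊗₁ id {A *}) ∘ λ⇒ †))) ≈ id

    -- conventions A** = A, (A ⊗ B)* = B* ⊗ A*, I* = I ...
    dual-involutive : ∀ A → (A *) * ≡ A
    dual-⊗ : ∀ A B → (A ⊗₀ B) * ≡ B * ⊗₀ A *
    dual-I : I * ≡ I
    -- ... under which the canonical isomorphisms between duals become
    -- identities, i.e. the chosen units are the canonical ones:
    u-dual : ∀ A →
      subst (Hom I) (cong (_⊗₀ (A *)) (dual-involutive A)) (u (A *)) ≈ σ ∘ u A
    u-⊗ : ∀ A B →
      subst (Hom I) (cong (_⊗₀ (A ⊗₀ B)) (dual-⊗ A B)) (u (A ⊗₀ B))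
        ≈ α⇒ † ∘ ((id ⊗₁ α⇒) ∘ ((id ⊗₁ (u A ⊗₁ id)) ∘ ((id ⊗₁ λ⇒ †) ∘ u B)))
    u-I : subst (Hom I) (cong (_⊗₀ I) dual-I) (u I) ≈ λ⇒ †

module _ {o ℓ e : Level} (𝒞 : CompactDaggerCategory o ℓ e) where
  open CompactDaggerCategory 𝒞

  cast : ∀ {A B} → A ≡ B → Hom A B
  cast {A} p = subst (Hom A) p id

  counit : ∀ A → Hom (A ⊗₀ A *) I
  counit A = u A † ∘ σ

  -- f_* : A* → B*, the transpose of f† :
  -- (id_{B*} ⊗ c_A) ∘ (id_{B*} ⊗ f† ⊗ id_{A*}) ∘ (u_B ⊗ id_{A*}), with coherence isos
  lower* : ∀ {A B} → Hom A B → Hom (A *) (B *)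
  lower* {A} {B} f =
    ρ⇒ ∘ ((id ⊗₁ counit A) ∘ (α⇒ ∘ (((id ⊗₁ f †) ⊗₁ id) ∘ ((u B ⊗₁ id) ∘ λ⇒ †))))

  record Monoid (A : Obj) : Set (ℓ ⊔ e) where
    field
      mult : Hom (A ⊗₀ A) A
      unit : Hom I A
      mult-assoc : mult ∘ (mult ⊗₁ id) ≈ mult ∘ ((id ⊗₁ mult) ∘ α⇒)
      unit-left : mult ∘ (unit ⊗₁ id) ≈ λ⇒
      unit-right : mult ∘ (id ⊗₁ unit) ≈ ρ⇒

  IsMonoidHom : ∀ {A B} → Hom (A ⊗₀ A) A → Hom I A → Hom (B ⊗₀ B) B → Hom I B →
                Hom A B → Set e
  IsMonoidHom mA eA mB eB f = (f ∘ mA ≈ mB ∘ (f ⊗₁ f)) × (f ∘ eA ≈ eB)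

  module _ {A : Obj} (M : Monoid A) where
    open Monoid M renaming (mult to m; unit to eₘ)

    -- the opposite monoid on A*: multiplication m_* (using (A ⊗ A)* = A* ⊗ A*)
    -- and unit e_* (using I* = I)
    opMult : Hom (A * ⊗₀ A *) (A *)
    opMult = lower* m ∘ cast (sym (dual-⊗ A A))

    opUnit : Hom I (A *)
    opUnit = lower* eₘ ∘ cast (sym dual-I)

    IsFrobenius : Set e
    IsFrobenius = (id ⊗₁ m) ∘ (α⇒ ∘ (m † ⊗₁ id)) ≈ (m ⊗₁ id) ∘ (α⇒ † ∘ (id ⊗₁ m †))

    IsInvolution : Hom A (A *) → Set e
    IsInvolution j =
      IsMonoidHom m eₘ opMult opUnit j × (cast (dual-involutive A) ∘ (lower* j ∘ j) ≈ id)

    inv : Hom A (A *)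
    inv = ρ⇒ ∘ ((id ⊗₁ (eₘ † ∘ m)) ∘ (α⇒ ∘ ((u A ⊗₁ id) ∘ λ⇒ †)))

    R : Hom A (A * ⊗₀ A)
    R = (id ⊗₁ m) ∘ (α⇒ ∘ ((u A ⊗₁ id) ∘ λ⇒ †))

  pantsMult : ∀ A → Hom ((A * ⊗₀ A) ⊗₀ (A * ⊗₀ A)) (A * ⊗₀ A)
  pantsMult A = (id ⊗₁ λ⇒) ∘ ((id ⊗₁ (counit A ⊗₁ id)) ∘ ((id ⊗₁ α⇒ †) ∘ α⇒))

  pantsUnit : ∀ A → Hom I (A * ⊗₀ A)
  pantsUnit A = u A

  pants-dual : ∀ A → (A * ⊗₀ A) * ≡ A * ⊗₀ A
  pants-dual A = trans (dual-⊗ (A *) A) (cong (A * ⊗₀_) (dual-involutive A))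

  pantsInv : ∀ A → Hom (A * ⊗₀ A) ((A * ⊗₀ A) *)
  pantsInv A = cast (sym (pants-dual A))

  IsInvolutiveMonoidHom : ∀ {A B} →
    Hom (A ⊗₀ A) A → Hom I A → Hom A (A *) →
    Hom (B ⊗₀ B) B → Hom I B → Hom B (B *) → Hom A B → Set e
  IsInvolutiveMonoidHom mA eA j mB eB k f =
    IsMonoidHom mA eA mB eB f × (k ∘ f ≈ lower* f ∘ j)

-- Let ε = e† ∘ m be the pairing of the monoid and L = (id ⊗ ε) ∘ (m† ⊗ id) (up to
-- coherence). The Frobenius law holds iff L = m. It gives L = m directly; conversely,
-- L = m yields m† = (m ⊗ id) ∘ (id ⊗ m† ∘ e) and, through the snake identity of ε,
-- its mirror image, and then both sides of the Frobenius law equal m† ∘ m.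
-- The involution i is the transpose of ε under Hom(A ⊗ X, I) ≅ Hom(X, A*), and R is m
-- bent along u_A. The monoid laws alone make R a monoid homomorphism into the pair of
-- pants and make i preserve the unit. Given L = m, transposing the remaining laws (i
-- multiplicative, i_* ∘ i = id, and R compatible with the involutions) reduces them to
-- associativity and snake identities. Conversely, transposing the last law gives
-- u† ∘ (id ⊗ m) = u† ∘ (id ⊗ L) (modulo α), and u† ∘ (id ⊗ -) is injective by the
-- snake identity, so L = m.

module Submission where

open import Defs
open import Level using (Level)
open import Data.Product using (_×_; _,_)
open import Function.Bundles using (_⇔_; mk⇔)
open import Relation.Binary using (Setoid; IsEquivalence)
open import Relation.Binary.PropositionalEquality using (_≡_; refl; sym; trans; cong; subst)
import Relation.Binary.Reasoning.Setoid as SetoidReasoning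

module Calculus {o ℓ e : Level} (𝒞 : CompactDaggerCategory o ℓ e) where
  open CompactDaggerCategory 𝒞

  hom-setoid : ∀ {A B} → Setoid ℓ e
  hom-setoid {A} {B} = record { Carrier = Hom A B ; _≈_ = _≈_ ; isEquivalence = ≈-equiv }

  module ≈ {A B : Obj} = IsEquivalence (≈-equiv {A} {B})
  module HomReasoning {A B : Obj} = SetoidReasoning (hom-setoid {A} {B})
  open HomReasoning

  infixr 4 _⟩∘⟨_ _⟩⊗⟨_ refl⟩∘⟨_
  infixl 5 _⟩∘⟨refl

  _⟩∘⟨_ : ∀ {A B C} {f f′ : Hom B C} {g g′ : Hom A B} → f ≈ f′ → g ≈ g′ → f ∘ g ≈ f′ ∘ g′
  _⟩∘⟨_ = ∘-resp-≈

  _⟩⊗⟨_ : ∀ {A B C D} {f f′ : Hom A B} {g g′ : Hom C D} → f ≈ f′ → g ≈ g′ → f ⊗₁ g ≈ f′ ⊗₁ g′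
  _⟩⊗⟨_ = ⊗-resp-≈

  refl⟩∘⟨_ : ∀ {A B C} {f : Hom B C} {g g′ : Hom A B} → g ≈ g′ → f ∘ g ≈ f ∘ g′
  refl⟩∘⟨ p = ∘-resp-≈ ≈.refl p

  _⟩∘⟨refl : ∀ {A B C} {f f′ : Hom B C} {g : Hom A B} → f ≈ f′ → f ∘ g ≈ f′ ∘ g
  p ⟩∘⟨refl = ∘-resp-≈ p ≈.refl

  assoc : ∀ {A B C D} {f : Hom A B} {g : Hom B C} {h : Hom C D} → (h ∘ g) ∘ f ≈ h ∘ (g ∘ f)
  assoc = ∘-assoc

  sym-assoc : ∀ {A B C D} {f : Hom A B} {g : Hom B C} {h : Hom C D} → h ∘ (g ∘ f) ≈ (h ∘ g) ∘ f
  sym-assoc = ≈.sym ∘-assoc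

  assoc⁴ : ∀ {A B C D E F} {f : Hom E F} {g : Hom D E} {h : Hom C D} {k : Hom B C} {l : Hom A B} →
    (f ∘ g ∘ h ∘ k) ∘ l ≈ f ∘ g ∘ h ∘ k ∘ l
  assoc⁴ = ≈.trans assoc (refl⟩∘⟨ ≈.trans assoc (refl⟩∘⟨ assoc))

  assoc⁵ : ∀ {A B C D E F G} {f : Hom F G} {g : Hom E F} {h : Hom D E} {k : Hom C D} {l : Hom B C} {m : Hom A B} →
    (f ∘ g ∘ h ∘ k ∘ l) ∘ m ≈ f ∘ g ∘ h ∘ k ∘ l ∘ m
  assoc⁵ = ≈.trans assoc (refl⟩∘⟨ assoc⁴)

  assoc⁶ : ∀ {A B C D E F G H} {f0 : Hom G H} {f : Hom F G} {g : Hom E F} {h : Hom D E} {k : Hom C D} {l : Hom B C} {m : Hom A B} →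
    (f0 ∘ f ∘ g ∘ h ∘ k ∘ l) ∘ m ≈ f0 ∘ f ∘ g ∘ h ∘ k ∘ l ∘ m
  assoc⁶ = ≈.trans assoc (refl⟩∘⟨ assoc⁵)

  extendʳ : ∀ {A B C D X} {f : Hom C D} {g : Hom B C} {h : Hom X D} {k : Hom B X} {r : Hom A B} →
    f ∘ g ≈ h ∘ k → f ∘ (g ∘ r) ≈ h ∘ (k ∘ r)
  extendʳ p = ≈.trans sym-assoc (≈.trans (p ⟩∘⟨refl) assoc)

  extendʳ₃₂ : ∀ {A B C D E F} {a : Hom D E} {b : Hom C D} {c : Hom B C} {d : Hom F E} {e′ : Hom B F} {r : Hom A B} →
    a ∘ b ∘ c ≈ d ∘ e′ → a ∘ b ∘ c ∘ r ≈ d ∘ e′ ∘ r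
  extendʳ₃₂ p = ≈.trans (refl⟩∘⟨ sym-assoc) (extendʳ p)

  extendʳ₂₃ : ∀ {A B C D X Y} {f : Hom C D} {g : Hom B C} {a : Hom Y D} {b : Hom X Y} {d : Hom B X} {r : Hom A B} →
    f ∘ g ≈ a ∘ b ∘ d → f ∘ g ∘ r ≈ a ∘ b ∘ d ∘ r
  extendʳ₂₃ p = ≈.trans (extendʳ p) (refl⟩∘⟨ assoc)

  pullˡ : ∀ {A B C D} {f : Hom C D} {g : Hom B C} {h : Hom B D} {r : Hom A B} →
    f ∘ g ≈ h → f ∘ (g ∘ r) ≈ h ∘ r
  pullˡ p = ≈.trans sym-assoc (p ⟩∘⟨refl)

  pushˡ : ∀ {A B C D} {f : Hom C D} {g : Hom B C} {h : Hom B D} {r : Hom A B} →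
    h ≈ f ∘ g → h ∘ r ≈ f ∘ (g ∘ r)
  pushˡ p = ≈.sym (pullˡ (≈.sym p))

  elimˡ : ∀ {A B} {f : Hom B B} {g : Hom A B} → f ≈ id → f ∘ g ≈ g
  elimˡ p = ≈.trans (p ⟩∘⟨refl) identityˡ

  elimʳ : ∀ {A B} {f : Hom A B} {g : Hom A A} → g ≈ id → f ∘ g ≈ f
  elimʳ p = ≈.trans (refl⟩∘⟨ p) identityʳ

  cancelˡ : ∀ {A B C} {f : Hom B C} {g : Hom C B} {h : Hom A C} → f ∘ g ≈ id → f ∘ (g ∘ h) ≈ h
  cancelˡ p = ≈.trans (pullˡ p) identityˡ

  cancel-split-epi : ∀ {X Y Z} {f g : Hom Y Z} {P : Hom X Y} {Q : Hom Y X} →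
    P ∘ Q ≈ id → f ∘ P ≈ g ∘ P → f ≈ g
  cancel-split-epi {f = f} {g} {P} {Q} pq h = begin
    f ≈⟨ elimʳ pq ⟨
    f ∘ (P ∘ Q) ≈⟨ sym-assoc ⟩
    (f ∘ P) ∘ Q ≈⟨ h ⟩∘⟨refl ⟩
    (g ∘ P) ∘ Q ≈⟨ assoc ⟩
    g ∘ (P ∘ Q) ≈⟨ elimʳ pq ⟩
    g ∎

  cancel-split-mono : ∀ {X Y Z} {f g : Hom X Y} {P : Hom Y Z} {Q : Hom Z Y} →
    Q ∘ P ≈ id → P ∘ f ≈ P ∘ g → f ≈ g
  cancel-split-mono {f = f} {g} {P} {Q} qp h = begin
    f ≈⟨ elimˡ qp ⟨
    (Q ∘ P) ∘ f ≈⟨ assoc ⟩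
    Q ∘ (P ∘ f) ≈⟨ refl⟩∘⟨ h ⟩
    Q ∘ (P ∘ g) ≈⟨ sym-assoc ⟩
    (Q ∘ P) ∘ g ≈⟨ elimˡ qp ⟩
    g ∎

  inverse-commute : ∀ {X Y X′ Y′} {P : Hom X X′} {Q : Hom X′ X} {P′ : Hom Y Y′} {Q′ : Hom Y′ Y}
             {F : Hom X Y} {G : Hom X′ Y′} →
             Q′ ∘ P′ ≈ id → P ∘ Q ≈ id → P′ ∘ F ≈ G ∘ P → F ∘ Q ≈ Q′ ∘ G
  inverse-commute {P = P} {Q} {P′} {Q′} {F} {G} qp pq h = begin
    F ∘ Q ≈⟨ elimˡ qp ⟨
    (Q′ ∘ P′) ∘ F ∘ Q ≈⟨ assoc ⟩
    Q′ ∘ P′ ∘ F ∘ Q ≈⟨ refl⟩∘⟨ pullˡ h ⟩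
    Q′ ∘ (G ∘ P) ∘ Q ≈⟨ refl⟩∘⟨ assoc ⟩
    Q′ ∘ G ∘ P ∘ Q ≈⟨ refl⟩∘⟨ elimʳ pq ⟩
    Q′ ∘ G ∎

  -- Functoriality of ⊗

  ⊗∘⊗ : ∀ {A B C D E F} {f : Hom A B} {g : Hom B C} {h : Hom D E} {k : Hom E F} →
    (g ⊗₁ k) ∘ (f ⊗₁ h) ≈ (g ∘ f) ⊗₁ (k ∘ h)
  ⊗∘⊗ = ≈.sym ⊗-homomorphism

  serialize₁₂ : ∀ {A B C D} {f : Hom A B} {g : Hom C D} → f ⊗₁ g ≈ (f ⊗₁ id) ∘ (id ⊗₁ g)
  serialize₁₂ = ≈.trans (≈.sym identityʳ ⟩⊗⟨ ≈.sym identityˡ) ⊗-homomorphism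

  serialize₂₁ : ∀ {A B C D} {f : Hom A B} {g : Hom C D} → f ⊗₁ g ≈ (id ⊗₁ g) ∘ (f ⊗₁ id)
  serialize₂₁ = ≈.trans (≈.sym identityˡ ⟩⊗⟨ ≈.sym identityʳ) ⊗-homomorphism

  ⊗-interchange : ∀ {A B C D} {f : Hom A B} {g : Hom C D} → (f ⊗₁ id) ∘ (id ⊗₁ g) ≈ (id ⊗₁ g) ∘ (f ⊗₁ id)
  ⊗-interchange = ≈.trans (≈.sym serialize₁₂) serialize₂₁

  ⊗-interchange˘ : ∀ {A B C D} {f : Hom A B} {g : Hom C D} → (id ⊗₁ g) ∘ (f ⊗₁ id) ≈ (f ⊗₁ id) ∘ (id ⊗₁ g)
  ⊗-interchange˘ = ≈.sym ⊗-interchange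

  id⊗∘id⊗ : ∀ {A B C D} {f : Hom B C} {g : Hom A B} → (id {D} ⊗₁ f) ∘ (id ⊗₁ g) ≈ id ⊗₁ (f ∘ g)
  id⊗∘id⊗ = ≈.trans ⊗∘⊗ (identityˡ ⟩⊗⟨ ≈.refl)

  ⊗id∘⊗id : ∀ {A B C D} {f : Hom B C} {g : Hom A B} → (f ⊗₁ id {D}) ∘ (g ⊗₁ id) ≈ (f ∘ g) ⊗₁ id
  ⊗id∘⊗id = ≈.trans ⊗∘⊗ (≈.refl ⟩⊗⟨ identityˡ)

  id⊗-split : ∀ {A B C D} {f : Hom B C} {g : Hom A B} → id {D} ⊗₁ (f ∘ g) ≈ (id ⊗₁ f) ∘ (id ⊗₁ g)
  id⊗-split = ≈.sym id⊗∘id⊗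

  ⊗id-split : ∀ {A B C D} {f : Hom B C} {g : Hom A B} → (f ∘ g) ⊗₁ id {D} ≈ (f ⊗₁ id) ∘ (g ⊗₁ id)
  ⊗id-split = ≈.sym ⊗id∘⊗id

  id⊗-split₃ : ∀ {A B C D G} {h : Hom C D} {k : Hom B C} {l : Hom A B} →
    id {G} ⊗₁ (h ∘ k ∘ l) ≈ (id ⊗₁ h) ∘ (id ⊗₁ k) ∘ (id ⊗₁ l)
  id⊗-split₃ = ≈.trans id⊗-split (refl⟩∘⟨ id⊗-split)

  id⊗-split₄ : ∀ {A B C D E G} {f : Hom D E} {h : Hom C D} {k : Hom B C} {l : Hom A B} →
    id {G} ⊗₁ (f ∘ h ∘ k ∘ l) ≈ (id ⊗₁ f) ∘ (id ⊗₁ h) ∘ (id ⊗₁ k) ∘ (id ⊗₁ l)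
  id⊗-split₄ = ≈.trans id⊗-split (refl⟩∘⟨ id⊗-split₃)

  id⊗-split₅ : ∀ {A B C D E F G} {f : Hom E F} {g : Hom D E} {h : Hom C D} {k : Hom B C} {l : Hom A B} →
    id {G} ⊗₁ (f ∘ g ∘ h ∘ k ∘ l) ≈ (id ⊗₁ f) ∘ (id ⊗₁ g) ∘ (id ⊗₁ h) ∘ (id ⊗₁ k) ∘ (id ⊗₁ l)
  id⊗-split₅ = ≈.trans id⊗-split (refl⟩∘⟨ id⊗-split₄)

  id⊗-split₆ : ∀ {A B C D E F G H} {f0 : Hom F G} {f : Hom E F} {g : Hom D E} {h : Hom C D} {k : Hom B C} {l : Hom A B} →
    id {H} ⊗₁ (f0 ∘ f ∘ g ∘ h ∘ k ∘ l) ≈ (id ⊗₁ f0) ∘ (id ⊗₁ f) ∘ (id ⊗₁ g) ∘ (id ⊗₁ h) ∘ (id ⊗₁ k) ∘ (id ⊗₁ l)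
  id⊗-split₆ = ≈.trans id⊗-split (refl⟩∘⟨ id⊗-split₅)

  ⊗id-split₃ : ∀ {A B C D G} {h : Hom C D} {k : Hom B C} {l : Hom A B} →
    (h ∘ k ∘ l) ⊗₁ id {G} ≈ (h ⊗₁ id) ∘ (k ⊗₁ id) ∘ (l ⊗₁ id)
  ⊗id-split₃ = ≈.trans ⊗id-split (refl⟩∘⟨ ⊗id-split)

  ⊗id-split₄ : ∀ {A B C D E G} {f : Hom D E} {h : Hom C D} {k : Hom B C} {l : Hom A B} →
    (f ∘ h ∘ k ∘ l) ⊗₁ id {G} ≈ (f ⊗₁ id) ∘ (h ⊗₁ id) ∘ (k ⊗₁ id) ∘ (l ⊗₁ id)
  ⊗id-split₄ = ≈.trans ⊗id-split (refl⟩∘⟨ ⊗id-split₃)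

  ⊗id-split₅ : ∀ {A B C D E F G} {f : Hom E F} {g : Hom D E} {h : Hom C D} {k : Hom B C} {l : Hom A B} →
    (f ∘ g ∘ h ∘ k ∘ l) ⊗₁ id {G} ≈ (f ⊗₁ id) ∘ (g ⊗₁ id) ∘ (h ⊗₁ id) ∘ (k ⊗₁ id) ∘ (l ⊗₁ id)
  ⊗id-split₅ = ≈.trans ⊗id-split (refl⟩∘⟨ ⊗id-split₄)

  id⊗-resp-≈ : ∀ {A B D} {f g : Hom A B} → f ≈ g → id {D} ⊗₁ f ≈ id ⊗₁ g
  id⊗-resp-≈ p = ≈.refl ⟩⊗⟨ p

  ⊗id-resp-≈ : ∀ {A B D} {f g : Hom A B} → f ≈ g → f ⊗₁ id {D} ≈ g ⊗₁ id
  ⊗id-resp-≈ p = p ⟩⊗⟨ ≈.refl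

  id⊗-inverse : ∀ {A B C} {f : Hom A B} {g : Hom B A} → g ∘ f ≈ id → (id {C} ⊗₁ g) ∘ (id ⊗₁ f) ≈ id
  id⊗-inverse p = ≈.trans id⊗∘id⊗ (≈.trans (id⊗-resp-≈ p) ⊗-identity)

  ⊗id-inverse : ∀ {A B C} {f : Hom A B} {g : Hom B A} → g ∘ f ≈ id → (g ⊗₁ id {C}) ∘ (f ⊗₁ id) ≈ id
  ⊗id-inverse p = ≈.trans ⊗id∘⊗id (≈.trans (⊗id-resp-≈ p) ⊗-identity)

  -- Coherence of the monoidal structure

  α⇐ : ∀ {A B C} → Hom (A ⊗₀ (B ⊗₀ C)) ((A ⊗₀ B) ⊗₀ C)
  α⇐ = α⇒ †

  λ⇐ : ∀ {A} → Hom A (I ⊗₀ A)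
  λ⇐ = λ⇒ †

  ρ⇐ : ∀ {A} → Hom A (A ⊗₀ I)
  ρ⇐ = ρ⇒ †

  I⊗-injective : ∀ {X Y} {f g : Hom X Y} → id {I} ⊗₁ f ≈ id ⊗₁ g → f ≈ g
  I⊗-injective {f = f} {g} h = begin
    f ≈⟨ elimʳ λ-unitaryʳ ⟨
    f ∘ (λ⇒ ∘ λ⇐) ≈⟨ sym-assoc ⟩
    (f ∘ λ⇒) ∘ λ⇐ ≈⟨ λ-natural ⟩∘⟨refl ⟨
    (λ⇒ ∘ (id ⊗₁ f)) ∘ λ⇐ ≈⟨ (refl⟩∘⟨ h) ⟩∘⟨refl ⟩
    (λ⇒ ∘ (id ⊗₁ g)) ∘ λ⇐ ≈⟨ λ-natural ⟩∘⟨refl ⟩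
    (g ∘ λ⇒) ∘ λ⇐ ≈⟨ assoc ⟩
    g ∘ (λ⇒ ∘ λ⇐) ≈⟨ elimʳ λ-unitaryʳ ⟩
    g ∎

  ⊗I-injective : ∀ {X Y} {f g : Hom X Y} → f ⊗₁ id {I} ≈ g ⊗₁ id → f ≈ g
  ⊗I-injective {f = f} {g} h = begin
    f ≈⟨ elimʳ ρ-unitaryʳ ⟨
    f ∘ (ρ⇒ ∘ ρ⇐) ≈⟨ sym-assoc ⟩
    (f ∘ ρ⇒) ∘ ρ⇐ ≈⟨ ρ-natural ⟩∘⟨refl ⟨
    (ρ⇒ ∘ (f ⊗₁ id)) ∘ ρ⇐ ≈⟨ (refl⟩∘⟨ h) ⟩∘⟨refl ⟩
    (ρ⇒ ∘ (g ⊗₁ id)) ∘ ρ⇐ ≈⟨ ρ-natural ⟩∘⟨refl ⟩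
    (g ∘ ρ⇒) ∘ ρ⇐ ≈⟨ assoc ⟩
    g ∘ (ρ⇒ ∘ ρ⇐) ≈⟨ elimʳ ρ-unitaryʳ ⟩
    g ∎

  kelly₁ : ∀ {A B} → λ⇒ {A ⊗₀ B} ∘ α⇒ ≈ λ⇒ ⊗₁ id
  kelly₁ {A} {B} = I⊗-injective (cancel-split-epi αP-inv (begin
    (id ⊗₁ (λ⇒ ∘ α⇒)) ∘ (α⇒ ∘ (α⇒ ⊗₁ id)) ≈⟨ id⊗∘id⊗ ⟩∘⟨refl ⟨
    ((id ⊗₁ λ⇒) ∘ (id ⊗₁ α⇒)) ∘ (α⇒ ∘ (α⇒ ⊗₁ id)) ≈⟨ assoc ⟩
    (id ⊗₁ λ⇒) ∘ ((id ⊗₁ α⇒) ∘ (α⇒ ∘ (α⇒ ⊗₁ id))) ≈⟨ refl⟩∘⟨ pentagon ⟩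
    (id ⊗₁ λ⇒) ∘ (α⇒ ∘ α⇒) ≈⟨ pullˡ triangle ⟩
    (ρ⇒ ⊗₁ id) ∘ α⇒ ≈⟨ (≈.refl ⟩⊗⟨ ⊗-identity) ⟩∘⟨refl ⟨
    (ρ⇒ ⊗₁ (id ⊗₁ id)) ∘ α⇒ ≈⟨ α-natural ⟨
    α⇒ ∘ ((ρ⇒ ⊗₁ id) ⊗₁ id) ≈⟨ refl⟩∘⟨ ⊗id-resp-≈ triangle ⟨
    α⇒ ∘ (((id ⊗₁ λ⇒) ∘ α⇒) ⊗₁ id) ≈⟨ refl⟩∘⟨ ⊗id∘⊗id ⟨
    α⇒ ∘ ((id ⊗₁ λ⇒) ⊗₁ id) ∘ (α⇒ ⊗₁ id) ≈⟨ extendʳ α-natural ⟩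
    (id ⊗₁ (λ⇒ ⊗₁ id)) ∘ (α⇒ ∘ (α⇒ ⊗₁ id)) ∎))
    where
      αP-inv : ∀ {A B C D} → (α⇒ {A} {B ⊗₀ C} {D} ∘ (α⇒ ⊗₁ id)) ∘ ((α⇐ ⊗₁ id) ∘ α⇐) ≈ id
      αP-inv = begin
        (α⇒ ∘ (α⇒ ⊗₁ id)) ∘ ((α⇐ ⊗₁ id) ∘ α⇐) ≈⟨ assoc ⟩
        α⇒ ∘ ((α⇒ ⊗₁ id) ∘ ((α⇐ ⊗₁ id) ∘ α⇐)) ≈⟨ refl⟩∘⟨ pullˡ (≈.trans ⊗id∘⊗id (≈.trans (⊗id-resp-≈ α-unitaryʳ) ⊗-identity)) ⟩
        α⇒ ∘ (id ∘ α⇐) ≈⟨ refl⟩∘⟨ identityˡ ⟩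
        α⇒ ∘ α⇐ ≈⟨ α-unitaryʳ ⟩
        id ∎

  I⊗λ≈λ : ∀ {X} → id {I} ⊗₁ λ⇒ {X} ≈ λ⇒
  I⊗λ≈λ = cancel-split-mono λ-unitaryˡ λ-natural

  kelly₃ : λ⇒ {I} ≈ ρ⇒
  kelly₃ = ⊗I-injective (begin
    λ⇒ ⊗₁ id ≈⟨ kelly₁ ⟨
    λ⇒ ∘ α⇒ ≈⟨ I⊗λ≈λ ⟩∘⟨refl ⟨
    (id ⊗₁ λ⇒) ∘ α⇒ ≈⟨ triangle ⟩
    ρ⇒ ⊗₁ id ∎)

  kelly₂ : ∀ {A B} → (id {A} ⊗₁ ρ⇒ {B}) ∘ α⇒ ≈ ρ⇒
  kelly₂ = ⊗I-injective (cancel-split-mono α-unitaryˡ (begin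
    α⇒ ∘ (((id ⊗₁ ρ⇒) ∘ α⇒) ⊗₁ id) ≈⟨ refl⟩∘⟨ ⊗id∘⊗id ⟨
    α⇒ ∘ ((id ⊗₁ ρ⇒) ⊗₁ id) ∘ (α⇒ ⊗₁ id) ≈⟨ extendʳ α-natural ⟩
    (id ⊗₁ (ρ⇒ ⊗₁ id)) ∘ α⇒ ∘ (α⇒ ⊗₁ id) ≈⟨ id⊗-resp-≈ triangle ⟩∘⟨refl ⟨
    (id ⊗₁ ((id ⊗₁ λ⇒) ∘ α⇒)) ∘ α⇒ ∘ (α⇒ ⊗₁ id) ≈⟨ id⊗∘id⊗ ⟩∘⟨refl ⟨
    ((id ⊗₁ (id ⊗₁ λ⇒)) ∘ (id ⊗₁ α⇒)) ∘ α⇒ ∘ (α⇒ ⊗₁ id) ≈⟨ assoc ⟩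
    (id ⊗₁ (id ⊗₁ λ⇒)) ∘ (id ⊗₁ α⇒) ∘ α⇒ ∘ (α⇒ ⊗₁ id) ≈⟨ refl⟩∘⟨ pentagon ⟩
    (id ⊗₁ (id ⊗₁ λ⇒)) ∘ α⇒ ∘ α⇒ ≈⟨ extendʳ α-natural ⟨
    α⇒ ∘ ((id ⊗₁ id) ⊗₁ λ⇒) ∘ α⇒ ≈⟨ refl⟩∘⟨ (⊗-identity ⟩⊗⟨ ≈.refl) ⟩∘⟨refl ⟩
    α⇒ ∘ (id ⊗₁ λ⇒) ∘ α⇒ ≈⟨ refl⟩∘⟨ triangle ⟩
    α⇒ ∘ (ρ⇒ ⊗₁ id) ∎))

  kelly₂′ : ∀ {A B} → id {A} ⊗₁ ρ⇒ {B} ≈ ρ⇒ ∘ α⇐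
  kelly₂′ = begin
    id ⊗₁ ρ⇒ ≈⟨ elimʳ α-unitaryʳ ⟨
    (id ⊗₁ ρ⇒) ∘ α⇒ ∘ α⇐ ≈⟨ pullˡ kelly₂ ⟩
    ρ⇒ ∘ α⇐ ∎

  λ∘σ≈ρ : ∀ {A} → λ⇒ ∘ σ {A} {I} ≈ ρ⇒
  λ∘σ≈ρ {A} = ⊗I-injective (cancel-split-mono (σ-unitaryˡ {A} {I}) (begin
    σ ∘ ((λ⇒ ∘ σ) ⊗₁ id) ≈⟨ refl⟩∘⟨ ⊗id∘⊗id ⟨
    σ ∘ (λ⇒ ⊗₁ id) ∘ (σ ⊗₁ id) ≈⟨ refl⟩∘⟨ pullˡ kelly₁ ⟨
    σ ∘ λ⇒ ∘ α⇒ ∘ (σ ⊗₁ id) ≈⟨ extendʳ λ-natural ⟨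
    λ⇒ ∘ (id ⊗₁ σ) ∘ α⇒ ∘ (σ ⊗₁ id) ≈⟨ refl⟩∘⟨ hexagon ⟩
    λ⇒ ∘ α⇒ ∘ σ ∘ α⇒ ≈⟨ pullˡ kelly₁ ⟩
    (λ⇒ ⊗₁ id) ∘ σ ∘ α⇒ ≈⟨ extendʳ σ-natural ⟨
    σ ∘ (id ⊗₁ λ⇒) ∘ α⇒ ≈⟨ refl⟩∘⟨ triangle ⟩
    σ ∘ (ρ⇒ ⊗₁ id) ∎))

  λ⇐-natural : ∀ {A B} {f : Hom A B} → (id ⊗₁ f) ∘ λ⇐ ≈ λ⇐ ∘ f
  λ⇐-natural = inverse-commute λ-unitaryˡ λ-unitaryʳ λ-natural

  ρ⇐-natural : ∀ {A B} {f : Hom A B} → (f ⊗₁ id) ∘ ρ⇐ ≈ ρ⇐ ∘ f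
  ρ⇐-natural = inverse-commute ρ-unitaryˡ ρ-unitaryʳ ρ-natural

  α⇐-natural : ∀ {A B C D E F} {f : Hom A B} {g : Hom C D} {h : Hom E F} →
    α⇐ ∘ (f ⊗₁ (g ⊗₁ h)) ≈ ((f ⊗₁ g) ⊗₁ h) ∘ α⇐
  α⇐-natural = ≈.sym (inverse-commute α-unitaryˡ α-unitaryʳ α-natural)

  triangle′ : ∀ {A B} → (ρ⇒ {A} ⊗₁ id {B}) ∘ α⇐ ≈ id ⊗₁ λ⇒
  triangle′ = begin
    (ρ⇒ ⊗₁ id) ∘ α⇐ ≈⟨ triangle ⟩∘⟨refl ⟨
    ((id ⊗₁ λ⇒) ∘ α⇒) ∘ α⇐ ≈⟨ ≈.trans assoc (elimʳ α-unitaryʳ) ⟩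
    id ⊗₁ λ⇒ ∎

  pentagon-id⊗α⇐ : ∀ {A B C D} → (id {A} ⊗₁ α⇐ {B} {C} {D}) ∘ α⇒ ∘ α⇒ ≈ α⇒ ∘ (α⇒ ⊗₁ id)
  pentagon-id⊗α⇐ = begin
    (id ⊗₁ α⇐) ∘ α⇒ ∘ α⇒ ≈⟨ refl⟩∘⟨ pentagon ⟨
    (id ⊗₁ α⇐) ∘ (id ⊗₁ α⇒) ∘ α⇒ ∘ (α⇒ ⊗₁ id) ≈⟨ cancelˡ (id⊗-inverse α-unitaryˡ) ⟩
    α⇒ ∘ (α⇒ ⊗₁ id) ∎

  pentagon-α⇐⊗id : ∀ {A B C D} → α⇒ ∘ α⇒ ∘ (α⇐ {A} {B} {C} ⊗₁ id {D}) ≈ (id ⊗₁ α⇒) ∘ α⇒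
  pentagon-α⇐⊗id = begin
    α⇒ ∘ α⇒ ∘ (α⇐ ⊗₁ id) ≈⟨ sym-assoc ⟩
    (α⇒ ∘ α⇒) ∘ (α⇐ ⊗₁ id) ≈⟨ pentagon ⟩∘⟨refl ⟨
    ((id ⊗₁ α⇒) ∘ α⇒ ∘ (α⇒ ⊗₁ id)) ∘ (α⇐ ⊗₁ id) ≈⟨ ≈.trans assoc (refl⟩∘⟨ ≈.trans assoc (refl⟩∘⟨ ⊗id-inverse α-unitaryʳ)) ⟩
    (id ⊗₁ α⇒) ∘ α⇒ ∘ id ≈⟨ refl⟩∘⟨ identityʳ ⟩
    (id ⊗₁ α⇒) ∘ α⇒ ∎

  pentagon-α⇐∘id⊗α : ∀ {A B C D} → α⇐ ∘ (id {A} ⊗₁ α⇒ {B} {C} {D}) ∘ α⇒ ≈ α⇒ ∘ (α⇐ ⊗₁ id)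
  pentagon-α⇐∘id⊗α = begin
    α⇐ ∘ (id ⊗₁ α⇒) ∘ α⇒ ≈⟨ refl⟩∘⟨ refl⟩∘⟨ elimʳ (≈.trans ⊗id∘⊗id (≈.trans (⊗id-resp-≈ α-unitaryʳ) ⊗-identity)) ⟨
    α⇐ ∘ (id ⊗₁ α⇒) ∘ α⇒ ∘ (α⇒ ⊗₁ id) ∘ (α⇐ ⊗₁ id) ≈⟨ refl⟩∘⟨ refl⟩∘⟨ sym-assoc ⟩
    α⇐ ∘ (id ⊗₁ α⇒) ∘ (α⇒ ∘ (α⇒ ⊗₁ id)) ∘ (α⇐ ⊗₁ id) ≈⟨ refl⟩∘⟨ sym-assoc ⟩
    α⇐ ∘ ((id ⊗₁ α⇒) ∘ (α⇒ ∘ (α⇒ ⊗₁ id))) ∘ (α⇐ ⊗₁ id) ≈⟨ refl⟩∘⟨ pentagon ⟩∘⟨refl ⟩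
    α⇐ ∘ (α⇒ ∘ α⇒) ∘ (α⇐ ⊗₁ id) ≈⟨ refl⟩∘⟨ assoc ⟩
    α⇐ ∘ α⇒ ∘ α⇒ ∘ (α⇐ ⊗₁ id) ≈⟨ cancelˡ α-unitaryˡ ⟩
    α⇒ ∘ (α⇐ ⊗₁ id) ∎

  pentagon-α⊗id∘α⇐ : ∀ {A B C D} → (α⇒ {A} {B} {C} ⊗₁ id {D}) ∘ α⇐ ≈ α⇐ ∘ (id ⊗₁ α⇐) ∘ α⇒
  pentagon-α⊗id∘α⇐ = begin
    (α⇒ ⊗₁ id) ∘ α⇐ ≈⟨ elimˡ (≈.trans (refl⟩∘⟨ ≈.trans (pullˡ (id⊗-inverse α-unitaryˡ)) identityˡ) α-unitaryˡ) ⟩∘⟨refl ⟨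
    ((α⇐ ∘ (id ⊗₁ α⇐) ∘ (id ⊗₁ α⇒) ∘ α⇒) ∘ (α⇒ ⊗₁ id)) ∘ α⇐ ≈⟨ assoc⁴ ⟩∘⟨refl ⟩
    (α⇐ ∘ (id ⊗₁ α⇐) ∘ (id ⊗₁ α⇒) ∘ α⇒ ∘ (α⇒ ⊗₁ id)) ∘ α⇐ ≈⟨ (refl⟩∘⟨ refl⟩∘⟨ pentagon) ⟩∘⟨refl ⟩
    (α⇐ ∘ (id ⊗₁ α⇐) ∘ α⇒ ∘ α⇒) ∘ α⇐ ≈⟨ assoc⁴ ⟩
    α⇐ ∘ (id ⊗₁ α⇐) ∘ α⇒ ∘ α⇒ ∘ α⇐ ≈⟨ refl⟩∘⟨ refl⟩∘⟨ refl⟩∘⟨ α-unitaryʳ ⟩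
    α⇐ ∘ (id ⊗₁ α⇐) ∘ α⇒ ∘ id ≈⟨ refl⟩∘⟨ refl⟩∘⟨ identityʳ ⟩
    α⇐ ∘ (id ⊗₁ α⇐) ∘ α⇒ ∎

  -- Daggers of the coherence isomorphisms

  †⊗id : ∀ {A B C} {f : Hom A B} → (f ⊗₁ id {C}) † ≈ f † ⊗₁ id
  †⊗id = ≈.trans ⊗-† (≈.refl ⟩⊗⟨ †-identity)

  id⊗† : ∀ {A B C} {f : Hom A B} → (id {C} ⊗₁ f) † ≈ id ⊗₁ f †
  id⊗† = ≈.trans ⊗-† (†-identity ⟩⊗⟨ ≈.refl)

  †-∘₄ : ∀ {A B C D E} {f : Hom D E} {g : Hom C D} {h : Hom B C} {k : Hom A B} →
    (f ∘ g ∘ h ∘ k) † ≈ k † ∘ h † ∘ g † ∘ f †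
  †-∘₄ = ≈.trans †-homomorphism (≈.trans (≈.trans †-homomorphism (†-homomorphism ⟩∘⟨refl) ⟩∘⟨refl) (≈.trans assoc assoc))

  †-∘₅ : ∀ {A B C D E F} {f : Hom E F} {g : Hom D E} {h : Hom C D} {k : Hom B C} {l : Hom A B} →
    (f ∘ g ∘ h ∘ k ∘ l) † ≈ l † ∘ k † ∘ h † ∘ g † ∘ f †
  †-∘₅ = ≈.trans †-homomorphism (≈.trans (†-∘₄ ⟩∘⟨refl) assoc⁴)

  triangle⇐ : ∀ {A B} → α⇒ ∘ (ρ⇐ {A} ⊗₁ id {B}) ≈ id ⊗₁ λ⇐
  triangle⇐ = begin
    α⇒ ∘ (ρ⇐ ⊗₁ id) ≈⟨ refl⟩∘⟨ †⊗id ⟨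
    α⇒ ∘ (ρ⇒ ⊗₁ id) † ≈⟨ refl⟩∘⟨ †-resp-≈ triangle ⟨
    α⇒ ∘ ((id ⊗₁ λ⇒) ∘ α⇒) † ≈⟨ refl⟩∘⟨ †-homomorphism ⟩
    α⇒ ∘ α⇐ ∘ (id ⊗₁ λ⇒) † ≈⟨ cancelˡ α-unitaryʳ ⟩
    (id ⊗₁ λ⇒) † ≈⟨ id⊗† ⟩
    id ⊗₁ λ⇐ ∎

  kelly₁⇐ : ∀ {A B} → α⇒ ∘ (λ⇐ {A} ⊗₁ id {B}) ≈ λ⇐
  kelly₁⇐ = begin
    α⇒ ∘ (λ⇐ ⊗₁ id) ≈⟨ refl⟩∘⟨ †⊗id ⟨
    α⇒ ∘ (λ⇒ ⊗₁ id) † ≈⟨ refl⟩∘⟨ †-resp-≈ kelly₁ ⟨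
    α⇒ ∘ (λ⇒ ∘ α⇒) † ≈⟨ refl⟩∘⟨ †-homomorphism ⟩
    α⇒ ∘ α⇐ ∘ λ⇐ ≈⟨ cancelˡ α-unitaryʳ ⟩
    λ⇐ ∎

  kelly₂⇐ : ∀ {A B} → α⇐ ∘ (id {A} ⊗₁ ρ⇐ {B}) ≈ ρ⇐
  kelly₂⇐ = begin
    α⇐ ∘ (id ⊗₁ ρ⇐) ≈⟨ refl⟩∘⟨ id⊗† ⟨
    α⇐ ∘ (id ⊗₁ ρ⇒) † ≈⟨ †-homomorphism ⟨
    ((id ⊗₁ ρ⇒) ∘ α⇒) † ≈⟨ †-resp-≈ kelly₂ ⟩
    ρ⇐ ∎

  kelly₃⇐ : λ⇐ {I} ≈ ρ⇐
  kelly₃⇐ = †-resp-≈ kelly₃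

  λ⇐⊗id : ∀ {A B} → λ⇐ {A} ⊗₁ id {B} ≈ α⇐ ∘ λ⇐
  λ⇐⊗id = begin
    λ⇐ ⊗₁ id ≈⟨ cancelˡ α-unitaryˡ ⟨
    α⇐ ∘ α⇒ ∘ (λ⇐ ⊗₁ id) ≈⟨ refl⟩∘⟨ kelly₁⇐ ⟩
    α⇐ ∘ λ⇐ ∎

  id⊗ρ⇐ : ∀ {A B} → id {A} ⊗₁ ρ⇐ {B} ≈ α⇒ ∘ ρ⇐
  id⊗ρ⇐ = begin
    id ⊗₁ ρ⇐ ≈⟨ cancelˡ α-unitaryʳ ⟨
    α⇒ ∘ α⇐ ∘ (id ⊗₁ ρ⇐) ≈⟨ refl⟩∘⟨ kelly₂⇐ ⟩
    α⇒ ∘ ρ⇐ ∎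

  pentagon⇐ : ∀ {A B C D} → (α⇐ ⊗₁ id) ∘ α⇐ ∘ (id ⊗₁ α⇐) ≈ α⇐ {A ⊗₀ B} {C} {D} ∘ α⇐
  pentagon⇐ = begin
    (α⇐ ⊗₁ id) ∘ α⇐ ∘ (id ⊗₁ α⇐) ≈⟨ †⊗id ⟩∘⟨ refl⟩∘⟨ id⊗† ⟨
    (α⇒ ⊗₁ id) † ∘ α⇐ ∘ (id ⊗₁ α⇒) † ≈⟨ ≈.trans †-homomorphism (≈.trans (†-homomorphism ⟩∘⟨refl) assoc) ⟨
    ((id ⊗₁ α⇒) ∘ α⇒ ∘ (α⇒ ⊗₁ id)) † ≈⟨ †-resp-≈ pentagon ⟩
    (α⇒ ∘ α⇒) † ≈⟨ †-homomorphism ⟩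
    α⇐ ∘ α⇐ ∎

  -- Transposition along units and counits

  c : ∀ A → Hom (A ⊗₀ A *) I
  c = counit 𝒞

  bend : ∀ {P Q X W} → Hom I (P ⊗₀ Q) → Hom (Q ⊗₀ X) W → Hom X (P ⊗₀ W)
  bend κ k = (id ⊗₁ k) ∘ (α⇒ ∘ ((κ ⊗₁ id) ∘ λ⇒ †))

  bend-resp-≈ : ∀ {P Q X W} {κ : Hom I (P ⊗₀ Q)} {k k′ : Hom (Q ⊗₀ X) W} → k ≈ k′ → bend κ k ≈ bend κ k′
  bend-resp-≈ p = id⊗-resp-≈ p ⟩∘⟨refl

  bend-∘ : ∀ {P Q X Y W} {κ : Hom I (P ⊗₀ Q)} {k : Hom (Q ⊗₀ X) W} {g : Hom Y X} →
    bend κ (k ∘ (id ⊗₁ g)) ≈ bend κ k ∘ g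
  bend-∘ {κ = κ} {k} {g} = begin
    (id ⊗₁ (k ∘ (id ⊗₁ g))) ∘ α⇒ ∘ (κ ⊗₁ id) ∘ λ⇐ ≈⟨ id⊗-split ⟩∘⟨refl ⟩
    ((id ⊗₁ k) ∘ (id ⊗₁ (id ⊗₁ g))) ∘ α⇒ ∘ (κ ⊗₁ id) ∘ λ⇐ ≈⟨ assoc ⟩
    (id ⊗₁ k) ∘ (id ⊗₁ (id ⊗₁ g)) ∘ α⇒ ∘ (κ ⊗₁ id) ∘ λ⇐ ≈⟨ refl⟩∘⟨ extendʳ α-natural ⟨
    (id ⊗₁ k) ∘ α⇒ ∘ ((id ⊗₁ id) ⊗₁ g) ∘ (κ ⊗₁ id) ∘ λ⇐ ≈⟨ refl⟩∘⟨ refl⟩∘⟨ extendʳ (≈.trans ((⊗-identity ⟩⊗⟨ ≈.refl) ⟩∘⟨refl) ⊗-interchange˘) ⟩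
    (id ⊗₁ k) ∘ α⇒ ∘ (κ ⊗₁ id) ∘ (id ⊗₁ g) ∘ λ⇐ ≈⟨ refl⟩∘⟨ refl⟩∘⟨ refl⟩∘⟨ λ⇐-natural ⟩
    (id ⊗₁ k) ∘ α⇒ ∘ (κ ⊗₁ id) ∘ λ⇐ ∘ g ≈⟨ assoc⁴ ⟨
    ((id ⊗₁ k) ∘ α⇒ ∘ (κ ⊗₁ id) ∘ λ⇐) ∘ g ∎

  curryAlong : ∀ {P Q X} → Hom I (P ⊗₀ Q) → Hom (Q ⊗₀ X) I → Hom X P
  curryAlong κ φ = ρ⇒ ∘ bend κ φ

  curry : ∀ B {X} → Hom (B ⊗₀ X) I → Hom X (B *)
  curry B = curryAlong (u B)

  uncurry : ∀ B {X} → Hom X (B *) → Hom (B ⊗₀ X) I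
  uncurry B g = c B ∘ (id ⊗₁ g)

  snake₁⊗ : ∀ {B Z} → λ⇒ ∘ (c B ⊗₁ id {B ⊗₀ Z}) ∘ α⇐ ∘ (id ⊗₁ α⇒) ∘ (id ⊗₁ (u B ⊗₁ id)) ∘ (id ⊗₁ λ⇐) ≈ id
  snake₁⊗ {B} = begin
    λ⇒ ∘ (c B ⊗₁ id) ∘ α⇐ ∘ (id ⊗₁ α⇒) ∘ (id ⊗₁ (u B ⊗₁ id)) ∘ (id ⊗₁ λ⇐)
      ≈⟨ refl⟩∘⟨ refl⟩∘⟨ refl⟩∘⟨ refl⟩∘⟨ refl⟩∘⟨ triangle⇐ ⟨
    λ⇒ ∘ (c B ⊗₁ id) ∘ α⇐ ∘ (id ⊗₁ α⇒) ∘ (id ⊗₁ (u B ⊗₁ id)) ∘ α⇒ ∘ (ρ⇐ ⊗₁ id)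
      ≈⟨ refl⟩∘⟨ refl⟩∘⟨ refl⟩∘⟨ refl⟩∘⟨ extendʳ α-natural ⟨
    λ⇒ ∘ (c B ⊗₁ id) ∘ α⇐ ∘ (id ⊗₁ α⇒) ∘ α⇒ ∘ ((id ⊗₁ u B) ⊗₁ id) ∘ (ρ⇐ ⊗₁ id)
      ≈⟨ refl⟩∘⟨ refl⟩∘⟨ extendʳ₃₂ pentagon-α⇐∘id⊗α ⟩
    λ⇒ ∘ (c B ⊗₁ id) ∘ α⇒ ∘ (α⇐ ⊗₁ id) ∘ ((id ⊗₁ u B) ⊗₁ id) ∘ (ρ⇐ ⊗₁ id)
      ≈⟨ refl⟩∘⟨ (≈.refl ⟩⊗⟨ ⊗-identity) ⟩∘⟨refl ⟨
    λ⇒ ∘ (c B ⊗₁ (id ⊗₁ id)) ∘ α⇒ ∘ (α⇐ ⊗₁ id) ∘ ((id ⊗₁ u B) ⊗₁ id) ∘ (ρ⇐ ⊗₁ id)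
      ≈⟨ refl⟩∘⟨ extendʳ α-natural ⟨
    λ⇒ ∘ α⇒ ∘ ((c B ⊗₁ id) ⊗₁ id) ∘ (α⇐ ⊗₁ id) ∘ ((id ⊗₁ u B) ⊗₁ id) ∘ (ρ⇐ ⊗₁ id)
      ≈⟨ pullˡ kelly₁ ⟩
    (λ⇒ ⊗₁ id) ∘ ((c B ⊗₁ id) ⊗₁ id) ∘ (α⇐ ⊗₁ id) ∘ ((id ⊗₁ u B) ⊗₁ id) ∘ (ρ⇐ ⊗₁ id)
      ≈⟨ ⊗id-split₅ ⟨
    (λ⇒ ∘ (c B ⊗₁ id) ∘ α⇐ ∘ (id ⊗₁ u B) ∘ ρ⇐) ⊗₁ id
      ≈⟨ ≈.trans (⊗id-resp-≈ snake₁) ⊗-identity ⟩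
    id ∎

  snake₂⊗ : ∀ {B Z} → (id ⊗₁ λ⇒) ∘ (id ⊗₁ (c B ⊗₁ id {Z})) ∘ (id ⊗₁ α⇐) ∘ α⇒ ∘ (u B ⊗₁ id) ∘ λ⇐ ≈ id
  snake₂⊗ {B} = begin
    (id ⊗₁ λ⇒) ∘ (id ⊗₁ (c B ⊗₁ id)) ∘ (id ⊗₁ α⇐) ∘ α⇒ ∘ (u B ⊗₁ id) ∘ λ⇐
      ≈⟨ refl⟩∘⟨ refl⟩∘⟨ refl⟩∘⟨ refl⟩∘⟨ refl⟩∘⟨ kelly₁⇐ ⟨
    (id ⊗₁ λ⇒) ∘ (id ⊗₁ (c B ⊗₁ id)) ∘ (id ⊗₁ α⇐) ∘ α⇒ ∘ (u B ⊗₁ id) ∘ α⇒ ∘ (λ⇐ ⊗₁ id)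
      ≈⟨ refl⟩∘⟨ refl⟩∘⟨ refl⟩∘⟨ refl⟩∘⟨ (≈.refl ⟩⊗⟨ ⊗-identity) ⟩∘⟨refl ⟨
    (id ⊗₁ λ⇒) ∘ (id ⊗₁ (c B ⊗₁ id)) ∘ (id ⊗₁ α⇐) ∘ α⇒ ∘ (u B ⊗₁ (id ⊗₁ id)) ∘ α⇒ ∘ (λ⇐ ⊗₁ id)
      ≈⟨ refl⟩∘⟨ refl⟩∘⟨ refl⟩∘⟨ refl⟩∘⟨ extendʳ α-natural ⟨
    (id ⊗₁ λ⇒) ∘ (id ⊗₁ (c B ⊗₁ id)) ∘ (id ⊗₁ α⇐) ∘ α⇒ ∘ α⇒ ∘ ((u B ⊗₁ id) ⊗₁ id) ∘ (λ⇐ ⊗₁ id)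
      ≈⟨ refl⟩∘⟨ refl⟩∘⟨ extendʳ₃₂ pentagon-id⊗α⇐ ⟩
    (id ⊗₁ λ⇒) ∘ (id ⊗₁ (c B ⊗₁ id)) ∘ α⇒ ∘ (α⇒ ⊗₁ id) ∘ ((u B ⊗₁ id) ⊗₁ id) ∘ (λ⇐ ⊗₁ id)
      ≈⟨ refl⟩∘⟨ extendʳ α-natural ⟨
    (id ⊗₁ λ⇒) ∘ α⇒ ∘ ((id ⊗₁ c B) ⊗₁ id) ∘ (α⇒ ⊗₁ id) ∘ ((u B ⊗₁ id) ⊗₁ id) ∘ (λ⇐ ⊗₁ id)
      ≈⟨ pullˡ triangle ⟩
    (ρ⇒ ⊗₁ id) ∘ ((id ⊗₁ c B) ⊗₁ id) ∘ (α⇒ ⊗₁ id) ∘ ((u B ⊗₁ id) ⊗₁ id) ∘ (λ⇐ ⊗₁ id)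
      ≈⟨ ⊗id-split₅ ⟨
    (ρ⇒ ∘ (id ⊗₁ c B) ∘ α⇒ ∘ (u B ⊗₁ id) ∘ λ⇐) ⊗₁ id
      ≈⟨ ≈.trans (⊗id-resp-≈ snake₂) ⊗-identity ⟩
    id ∎

  curry-resp-≈ : ∀ {B X} {φ ψ : Hom (B ⊗₀ X) I} → φ ≈ ψ → curry B φ ≈ curry B ψ
  curry-resp-≈ p = refl⟩∘⟨ (id⊗-resp-≈ p) ⟩∘⟨refl

  uncurry-resp-≈ : ∀ {B X} {g g′ : Hom X (B *)} → g ≈ g′ → uncurry B g ≈ uncurry B g′
  uncurry-resp-≈ p = refl⟩∘⟨ id⊗-resp-≈ p

  curry-uncurry : ∀ {B X} {g : Hom X (B *)} → curry B (uncurry B g) ≈ g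
  curry-uncurry {B} {g = g} = begin
    ρ⇒ ∘ (id ⊗₁ (c B ∘ (id ⊗₁ g))) ∘ α⇒ ∘ (u B ⊗₁ id) ∘ λ⇐ ≈⟨ refl⟩∘⟨ id⊗-split ⟩∘⟨refl ⟩
    ρ⇒ ∘ ((id ⊗₁ c B) ∘ (id ⊗₁ (id ⊗₁ g))) ∘ α⇒ ∘ (u B ⊗₁ id) ∘ λ⇐ ≈⟨ refl⟩∘⟨ assoc ⟩
    ρ⇒ ∘ (id ⊗₁ c B) ∘ (id ⊗₁ (id ⊗₁ g)) ∘ α⇒ ∘ (u B ⊗₁ id) ∘ λ⇐ ≈⟨ refl⟩∘⟨ refl⟩∘⟨ extendʳ α-natural ⟨
    ρ⇒ ∘ (id ⊗₁ c B) ∘ α⇒ ∘ ((id ⊗₁ id) ⊗₁ g) ∘ (u B ⊗₁ id) ∘ λ⇐ ≈⟨ refl⟩∘⟨ refl⟩∘⟨ refl⟩∘⟨ extendʳ (≈.trans ((⊗-identity ⟩⊗⟨ ≈.refl) ⟩∘⟨refl) ⊗-interchange˘) ⟩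
    ρ⇒ ∘ (id ⊗₁ c B) ∘ α⇒ ∘ (u B ⊗₁ id) ∘ (id ⊗₁ g) ∘ λ⇐ ≈⟨ refl⟩∘⟨ refl⟩∘⟨ refl⟩∘⟨ refl⟩∘⟨ λ⇐-natural ⟩
    ρ⇒ ∘ (id ⊗₁ c B) ∘ α⇒ ∘ (u B ⊗₁ id) ∘ λ⇐ ∘ g ≈⟨ assoc⁵ ⟨
    (ρ⇒ ∘ (id ⊗₁ c B) ∘ α⇒ ∘ (u B ⊗₁ id) ∘ λ⇐) ∘ g ≈⟨ elimˡ snake₂ ⟩
    g ∎

  uncurry-curry : ∀ {B X} {φ : Hom (B ⊗₀ X) I} → uncurry B (curry B φ) ≈ φ
  uncurry-curry {B} {φ = φ} = begin
    c B ∘ (id ⊗₁ (ρ⇒ ∘ (id ⊗₁ φ) ∘ α⇒ ∘ (u B ⊗₁ id) ∘ λ⇐))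
      ≈⟨ refl⟩∘⟨ id⊗-split₅ ⟩
    c B ∘ (id ⊗₁ ρ⇒) ∘ (id ⊗₁ (id ⊗₁ φ)) ∘ (id ⊗₁ α⇒) ∘ (id ⊗₁ (u B ⊗₁ id)) ∘ (id ⊗₁ λ⇐)
      ≈⟨ refl⟩∘⟨ kelly₂′ ⟩∘⟨refl ⟩
    c B ∘ (ρ⇒ ∘ α⇐) ∘ (id ⊗₁ (id ⊗₁ φ)) ∘ (id ⊗₁ α⇒) ∘ (id ⊗₁ (u B ⊗₁ id)) ∘ (id ⊗₁ λ⇐)
      ≈⟨ refl⟩∘⟨ assoc ⟩
    c B ∘ ρ⇒ ∘ α⇐ ∘ (id ⊗₁ (id ⊗₁ φ)) ∘ (id ⊗₁ α⇒) ∘ (id ⊗₁ (u B ⊗₁ id)) ∘ (id ⊗₁ λ⇐)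
      ≈⟨ refl⟩∘⟨ refl⟩∘⟨ extendʳ α⇐-natural ⟩
    c B ∘ ρ⇒ ∘ ((id ⊗₁ id) ⊗₁ φ) ∘ α⇐ ∘ (id ⊗₁ α⇒) ∘ (id ⊗₁ (u B ⊗₁ id)) ∘ (id ⊗₁ λ⇐)
      ≈⟨ extendʳ ρ-natural ⟨
    ρ⇒ ∘ (c B ⊗₁ id) ∘ ((id ⊗₁ id) ⊗₁ φ) ∘ α⇐ ∘ (id ⊗₁ α⇒) ∘ (id ⊗₁ (u B ⊗₁ id)) ∘ (id ⊗₁ λ⇐)
      ≈⟨ refl⟩∘⟨ extendʳ (≈.trans (refl⟩∘⟨ (⊗-identity ⟩⊗⟨ ≈.refl)) ⊗-interchange) ⟩
    ρ⇒ ∘ (id ⊗₁ φ) ∘ (c B ⊗₁ id) ∘ α⇐ ∘ (id ⊗₁ α⇒) ∘ (id ⊗₁ (u B ⊗₁ id)) ∘ (id ⊗₁ λ⇐)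
      ≈⟨ kelly₃ ⟩∘⟨refl ⟨
    λ⇒ ∘ (id ⊗₁ φ) ∘ (c B ⊗₁ id) ∘ α⇐ ∘ (id ⊗₁ α⇒) ∘ (id ⊗₁ (u B ⊗₁ id)) ∘ (id ⊗₁ λ⇐)
      ≈⟨ extendʳ λ-natural ⟩
    φ ∘ λ⇒ ∘ (c B ⊗₁ id) ∘ α⇐ ∘ (id ⊗₁ α⇒) ∘ (id ⊗₁ (u B ⊗₁ id)) ∘ (id ⊗₁ λ⇐)
      ≈⟨ elimʳ snake₁⊗ ⟩
    φ ∎

  uncurry-injective : ∀ {B X} {g g′ : Hom X (B *)} → uncurry B g ≈ uncurry B g′ → g ≈ g′
  uncurry-injective p = ≈.trans (≈.sym curry-uncurry) (≈.trans (curry-resp-≈ p) curry-uncurry)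

  uncurry-∘ : ∀ {B X Y} {g : Hom X (B *)} {h : Hom Y X} → uncurry B (g ∘ h) ≈ uncurry B g ∘ (id ⊗₁ h)
  uncurry-∘ = ≈.trans (refl⟩∘⟨ id⊗-split) sym-assoc

  uncurry-≈ : ∀ {B X} {φ : Hom (B ⊗₀ X) I} {g : Hom X (B *)} → g ≈ curry B φ → uncurry B g ≈ φ
  uncurry-≈ p = ≈.trans (uncurry-resp-≈ p) uncurry-curry

  lower*≈curry : ∀ {A B} {f : Hom A B} → lower* 𝒞 f ≈ curry B (c A ∘ (f † ⊗₁ id))
  lower*≈curry {A} {B} {f} = begin
    ρ⇒ ∘ (id ⊗₁ c A) ∘ α⇒ ∘ ((id ⊗₁ f †) ⊗₁ id) ∘ (u B ⊗₁ id) ∘ λ⇐ ≈⟨ refl⟩∘⟨ refl⟩∘⟨ extendʳ α-natural ⟩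
    ρ⇒ ∘ (id ⊗₁ c A) ∘ (id ⊗₁ (f † ⊗₁ id)) ∘ α⇒ ∘ (u B ⊗₁ id) ∘ λ⇐ ≈⟨ refl⟩∘⟨ pullˡ id⊗∘id⊗ ⟩
    ρ⇒ ∘ (id ⊗₁ (c A ∘ (f † ⊗₁ id))) ∘ α⇒ ∘ (u B ⊗₁ id) ∘ λ⇐ ∎

  uncurry-lower* : ∀ {A B} {f : Hom A B} → uncurry B (lower* 𝒞 f) ≈ c A ∘ (f † ⊗₁ id)
  uncurry-lower* = ≈.trans (uncurry-resp-≈ lower*≈curry) uncurry-curry

  unbend : ∀ B {Z W} → Hom Z (B * ⊗₀ W) → Hom (B ⊗₀ Z) W
  unbend B g = λ⇒ ∘ ((c B ⊗₁ id) ∘ (α⇐ ∘ (id ⊗₁ g)))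

  unbend-bend : ∀ {B Z W} {k : Hom (B ⊗₀ Z) W} → unbend B (bend (u B) k) ≈ k
  unbend-bend {B} {k = k} = begin
    λ⇒ ∘ (c B ⊗₁ id) ∘ α⇐ ∘ (id ⊗₁ ((id ⊗₁ k) ∘ α⇒ ∘ (u B ⊗₁ id) ∘ λ⇐))
      ≈⟨ refl⟩∘⟨ refl⟩∘⟨ refl⟩∘⟨ id⊗-split₄ ⟩
    λ⇒ ∘ (c B ⊗₁ id) ∘ α⇐ ∘ (id ⊗₁ (id ⊗₁ k)) ∘ (id ⊗₁ α⇒) ∘ (id ⊗₁ (u B ⊗₁ id)) ∘ (id ⊗₁ λ⇐)
      ≈⟨ refl⟩∘⟨ refl⟩∘⟨ extendʳ α⇐-natural ⟩
    λ⇒ ∘ (c B ⊗₁ id) ∘ ((id ⊗₁ id) ⊗₁ k) ∘ α⇐ ∘ (id ⊗₁ α⇒) ∘ (id ⊗₁ (u B ⊗₁ id)) ∘ (id ⊗₁ λ⇐)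
      ≈⟨ refl⟩∘⟨ extendʳ (≈.trans (refl⟩∘⟨ (⊗-identity ⟩⊗⟨ ≈.refl)) ⊗-interchange) ⟩
    λ⇒ ∘ (id ⊗₁ k) ∘ (c B ⊗₁ id) ∘ α⇐ ∘ (id ⊗₁ α⇒) ∘ (id ⊗₁ (u B ⊗₁ id)) ∘ (id ⊗₁ λ⇐)
      ≈⟨ extendʳ λ-natural ⟩
    k ∘ λ⇒ ∘ (c B ⊗₁ id) ∘ α⇐ ∘ (id ⊗₁ α⇒) ∘ (id ⊗₁ (u B ⊗₁ id)) ∘ (id ⊗₁ λ⇐)
      ≈⟨ elimʳ snake₁⊗ ⟩
    k ∎

  snake₁† : ∀ {A} → ρ⇒ ∘ (id ⊗₁ u A †) ∘ α⇒ ∘ (c A † ⊗₁ id) ∘ λ⇐ ≈ id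
  snake₁† {A} = begin
    ρ⇒ ∘ (id ⊗₁ u A †) ∘ α⇒ ∘ (c A † ⊗₁ id) ∘ λ⇐
      ≈⟨ †-involutive ⟩∘⟨ id⊗† ⟩∘⟨ †-involutive ⟩∘⟨ †⊗id ⟩∘⟨ ≈.refl ⟨
    ρ⇐ † ∘ (id ⊗₁ u A) † ∘ α⇐ † ∘ (c A ⊗₁ id) † ∘ λ⇒ † ≈⟨ †-∘₅ ⟨
    (λ⇒ ∘ (c A ⊗₁ id) ∘ α⇐ ∘ (id ⊗₁ u A) ∘ ρ⇐) † ≈⟨ †-resp-≈ snake₁ ⟩
    id † ≈⟨ †-identity ⟩
    id ∎

  u†∘id⊗-injective : ∀ {A X} {f g : Hom X A} → u A † ∘ (id ⊗₁ f) ≈ u A † ∘ (id ⊗₁ g) → f ≈ g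
  u†∘id⊗-injective {A} {f = f} {g} p = begin
    f ≈⟨ elimˡ snake₁† ⟨
    (ρ⇒ ∘ bend (c A †) (u A †)) ∘ f ≈⟨ assoc ⟩
    ρ⇒ ∘ (bend (c A †) (u A †) ∘ f) ≈⟨ refl⟩∘⟨ bend-∘ ⟨
    ρ⇒ ∘ bend (c A †) (u A † ∘ (id ⊗₁ f)) ≈⟨ refl⟩∘⟨ bend-resp-≈ p ⟩
    ρ⇒ ∘ bend (c A †) (u A † ∘ (id ⊗₁ g)) ≈⟨ refl⟩∘⟨ bend-∘ ⟩
    ρ⇒ ∘ (bend (c A †) (u A †) ∘ g) ≈⟨ sym-assoc ⟩
    (ρ⇒ ∘ bend (c A †) (u A †)) ∘ g ≈⟨ elimˡ snake₁† ⟩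
    g ∎

  contraction-assoc : ∀ {X P Q Y Z} {h : Hom X (P ⊗₀ Q)} {φ : Hom (Q ⊗₀ Y) I} →
    (id ⊗₁ λ⇒) ∘ (id ⊗₁ (φ ⊗₁ id {Z})) ∘ (id ⊗₁ α⇐) ∘ α⇒ ∘ (h ⊗₁ id)
    ≈ ((ρ⇒ ∘ (id ⊗₁ φ) ∘ α⇒ ∘ (h ⊗₁ id)) ⊗₁ id) ∘ α⇐
  contraction-assoc {h = h} {φ} = ≈.sym (begin
    ((ρ⇒ ∘ (id ⊗₁ φ) ∘ α⇒ ∘ (h ⊗₁ id)) ⊗₁ id) ∘ α⇐
      ≈⟨ ⊗id-split₄ ⟩∘⟨refl ⟩
    ((ρ⇒ ⊗₁ id) ∘ ((id ⊗₁ φ) ⊗₁ id) ∘ (α⇒ ⊗₁ id) ∘ ((h ⊗₁ id) ⊗₁ id)) ∘ α⇐ ≈⟨ assoc⁴ ⟩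
    (ρ⇒ ⊗₁ id) ∘ ((id ⊗₁ φ) ⊗₁ id) ∘ (α⇒ ⊗₁ id) ∘ ((h ⊗₁ id) ⊗₁ id) ∘ α⇐
      ≈⟨ refl⟩∘⟨ refl⟩∘⟨ refl⟩∘⟨ α⇐-natural ⟨
    (ρ⇒ ⊗₁ id) ∘ ((id ⊗₁ φ) ⊗₁ id) ∘ (α⇒ ⊗₁ id) ∘ α⇐ ∘ (h ⊗₁ (id ⊗₁ id))
      ≈⟨ refl⟩∘⟨ refl⟩∘⟨ extendʳ pentagon-α⊗id∘α⇐ ⟩
    (ρ⇒ ⊗₁ id) ∘ ((id ⊗₁ φ) ⊗₁ id) ∘ α⇐ ∘ ((id ⊗₁ α⇐) ∘ α⇒) ∘ (h ⊗₁ (id ⊗₁ id))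
      ≈⟨ refl⟩∘⟨ extendʳ α⇐-natural ⟨
    (ρ⇒ ⊗₁ id) ∘ α⇐ ∘ (id ⊗₁ (φ ⊗₁ id)) ∘ ((id ⊗₁ α⇐) ∘ α⇒) ∘ (h ⊗₁ (id ⊗₁ id))
      ≈⟨ pullˡ triangle′ ⟩
    (id ⊗₁ λ⇒) ∘ (id ⊗₁ (φ ⊗₁ id)) ∘ ((id ⊗₁ α⇐) ∘ α⇒) ∘ (h ⊗₁ (id ⊗₁ id))
      ≈⟨ refl⟩∘⟨ refl⟩∘⟨ ≈.trans assoc (refl⟩∘⟨ refl⟩∘⟨ (≈.refl ⟩⊗⟨ ⊗-identity)) ⟩
    (id ⊗₁ λ⇒) ∘ (id ⊗₁ (φ ⊗₁ id)) ∘ (id ⊗₁ α⇐) ∘ α⇒ ∘ (h ⊗₁ id) ∎)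

  contraction-exchange : ∀ {P Q X R Y} {g : Hom (P ⊗₀ Q) I} {h : Hom X (Q ⊗₀ R)} {φ : Hom (R ⊗₀ Y) I} →
    φ ∘ ((λ⇒ ∘ (g ⊗₁ id) ∘ α⇐ ∘ (id ⊗₁ h)) ⊗₁ id) ≈ g ∘ (id ⊗₁ (ρ⇒ ∘ (id ⊗₁ φ) ∘ α⇒ ∘ (h ⊗₁ id))) ∘ α⇒
  contraction-exchange {g = g} {h} {φ} = begin
    φ ∘ ((λ⇒ ∘ (g ⊗₁ id) ∘ α⇐ ∘ (id ⊗₁ h)) ⊗₁ id) ≈⟨ refl⟩∘⟨ ⊗id-split₄ ⟩
    φ ∘ (λ⇒ ⊗₁ id) ∘ ((g ⊗₁ id) ⊗₁ id) ∘ (α⇐ ⊗₁ id) ∘ ((id ⊗₁ h) ⊗₁ id) ≈⟨ refl⟩∘⟨ pushˡ (≈.sym kelly₁) ⟩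
    φ ∘ λ⇒ ∘ α⇒ ∘ ((g ⊗₁ id) ⊗₁ id) ∘ (α⇐ ⊗₁ id) ∘ ((id ⊗₁ h) ⊗₁ id) ≈⟨ extendʳ λ-natural ⟨
    λ⇒ ∘ (id ⊗₁ φ) ∘ α⇒ ∘ ((g ⊗₁ id) ⊗₁ id) ∘ (α⇐ ⊗₁ id) ∘ ((id ⊗₁ h) ⊗₁ id) ≈⟨ refl⟩∘⟨ refl⟩∘⟨ extendʳ α-natural ⟩
    λ⇒ ∘ (id ⊗₁ φ) ∘ (g ⊗₁ (id ⊗₁ id)) ∘ α⇒ ∘ (α⇐ ⊗₁ id) ∘ ((id ⊗₁ h) ⊗₁ id) ≈⟨ refl⟩∘⟨ refl⟩∘⟨ (≈.refl ⟩⊗⟨ ⊗-identity) ⟩∘⟨refl ⟩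
    λ⇒ ∘ (id ⊗₁ φ) ∘ (g ⊗₁ id) ∘ α⇒ ∘ (α⇐ ⊗₁ id) ∘ ((id ⊗₁ h) ⊗₁ id) ≈⟨ refl⟩∘⟨ extendʳ ⊗-interchange˘ ⟩
    λ⇒ ∘ (g ⊗₁ id) ∘ (id ⊗₁ φ) ∘ α⇒ ∘ (α⇐ ⊗₁ id) ∘ ((id ⊗₁ h) ⊗₁ id) ≈⟨ kelly₃ ⟩∘⟨refl ⟩
    ρ⇒ ∘ (g ⊗₁ id) ∘ (id ⊗₁ φ) ∘ α⇒ ∘ (α⇐ ⊗₁ id) ∘ ((id ⊗₁ h) ⊗₁ id) ≈⟨ extendʳ ρ-natural ⟩
    g ∘ ρ⇒ ∘ (id ⊗₁ φ) ∘ α⇒ ∘ (α⇐ ⊗₁ id) ∘ ((id ⊗₁ h) ⊗₁ id) ≈⟨ refl⟩∘⟨ pushˡ (≈.sym kelly₂) ⟩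
    g ∘ (id ⊗₁ ρ⇒) ∘ α⇒ ∘ (id ⊗₁ φ) ∘ α⇒ ∘ (α⇐ ⊗₁ id) ∘ ((id ⊗₁ h) ⊗₁ id) ≈⟨ refl⟩∘⟨ refl⟩∘⟨ refl⟩∘⟨ (⊗-identity ⟩⊗⟨ ≈.refl) ⟩∘⟨refl ⟨
    g ∘ (id ⊗₁ ρ⇒) ∘ α⇒ ∘ ((id ⊗₁ id) ⊗₁ φ) ∘ α⇒ ∘ (α⇐ ⊗₁ id) ∘ ((id ⊗₁ h) ⊗₁ id) ≈⟨ refl⟩∘⟨ refl⟩∘⟨ extendʳ α-natural ⟩
    g ∘ (id ⊗₁ ρ⇒) ∘ (id ⊗₁ (id ⊗₁ φ)) ∘ α⇒ ∘ α⇒ ∘ (α⇐ ⊗₁ id) ∘ ((id ⊗₁ h) ⊗₁ id) ≈⟨ refl⟩∘⟨ refl⟩∘⟨ refl⟩∘⟨ extendʳ₃₂ pentagon-α⇐⊗id ⟩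
    g ∘ (id ⊗₁ ρ⇒) ∘ (id ⊗₁ (id ⊗₁ φ)) ∘ (id ⊗₁ α⇒) ∘ α⇒ ∘ ((id ⊗₁ h) ⊗₁ id) ≈⟨ refl⟩∘⟨ refl⟩∘⟨ refl⟩∘⟨ refl⟩∘⟨ α-natural ⟩
    g ∘ (id ⊗₁ ρ⇒) ∘ (id ⊗₁ (id ⊗₁ φ)) ∘ (id ⊗₁ α⇒) ∘ (id ⊗₁ (h ⊗₁ id)) ∘ α⇒ ≈⟨ refl⟩∘⟨ ≈.trans (id⊗-split₄ ⟩∘⟨refl) assoc⁴ ⟨
    g ∘ (id ⊗₁ (ρ⇒ ∘ (id ⊗₁ φ) ∘ α⇒ ∘ (h ⊗₁ id))) ∘ α⇒ ∎

  curry⊗id-∘ : ∀ {B X Y} {φ : Hom (B ⊗₀ X) I} {h : Hom I (X ⊗₀ Y)} →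
    (curry B φ ⊗₁ id) ∘ h ≈ (id ⊗₁ (λ⇒ ∘ (φ ⊗₁ id) ∘ α⇐ ∘ (id ⊗₁ h) ∘ ρ⇐)) ∘ u B
  curry⊗id-∘ {B} {φ = φ} {h} = begin
    ((ρ⇒ ∘ (id ⊗₁ φ) ∘ α⇒ ∘ (u B ⊗₁ id) ∘ λ⇐) ⊗₁ id) ∘ h
      ≈⟨ ⊗id-split₅ ⟩∘⟨refl ⟩
    ((ρ⇒ ⊗₁ id) ∘ ((id ⊗₁ φ) ⊗₁ id) ∘ (α⇒ ⊗₁ id) ∘ ((u B ⊗₁ id) ⊗₁ id) ∘ (λ⇐ ⊗₁ id)) ∘ h ≈⟨ assoc⁵ ⟩
    (ρ⇒ ⊗₁ id) ∘ ((id ⊗₁ φ) ⊗₁ id) ∘ (α⇒ ⊗₁ id) ∘ ((u B ⊗₁ id) ⊗₁ id) ∘ (λ⇐ ⊗₁ id) ∘ h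
      ≈⟨ refl⟩∘⟨ refl⟩∘⟨ refl⟩∘⟨ refl⟩∘⟨ pushˡ λ⇐⊗id ⟩
    (ρ⇒ ⊗₁ id) ∘ ((id ⊗₁ φ) ⊗₁ id) ∘ (α⇒ ⊗₁ id) ∘ ((u B ⊗₁ id) ⊗₁ id) ∘ α⇐ ∘ λ⇐ ∘ h
      ≈⟨ refl⟩∘⟨ refl⟩∘⟨ refl⟩∘⟨ refl⟩∘⟨ refl⟩∘⟨ λ⇐-natural ⟨
    (ρ⇒ ⊗₁ id) ∘ ((id ⊗₁ φ) ⊗₁ id) ∘ (α⇒ ⊗₁ id) ∘ ((u B ⊗₁ id) ⊗₁ id) ∘ α⇐ ∘ (id ⊗₁ h) ∘ λ⇐
      ≈⟨ refl⟩∘⟨ refl⟩∘⟨ refl⟩∘⟨ extendʳ α⇐-natural ⟨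
    (ρ⇒ ⊗₁ id) ∘ ((id ⊗₁ φ) ⊗₁ id) ∘ (α⇒ ⊗₁ id) ∘ α⇐ ∘ (u B ⊗₁ (id ⊗₁ id)) ∘ (id ⊗₁ h) ∘ λ⇐
      ≈⟨ refl⟩∘⟨ refl⟩∘⟨ refl⟩∘⟨ refl⟩∘⟨ extendʳ (≈.trans ((≈.refl ⟩⊗⟨ ⊗-identity) ⟩∘⟨refl) ⊗-interchange) ⟩
    (ρ⇒ ⊗₁ id) ∘ ((id ⊗₁ φ) ⊗₁ id) ∘ (α⇒ ⊗₁ id) ∘ α⇐ ∘ (id ⊗₁ h) ∘ (u B ⊗₁ id) ∘ λ⇐
      ≈⟨ refl⟩∘⟨ refl⟩∘⟨ extendʳ pentagon-α⊗id∘α⇐ ⟩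
    (ρ⇒ ⊗₁ id) ∘ ((id ⊗₁ φ) ⊗₁ id) ∘ α⇐ ∘ ((id ⊗₁ α⇐) ∘ α⇒) ∘ (id ⊗₁ h) ∘ (u B ⊗₁ id) ∘ λ⇐
      ≈⟨ refl⟩∘⟨ extendʳ α⇐-natural ⟨
    (ρ⇒ ⊗₁ id) ∘ α⇐ ∘ (id ⊗₁ (φ ⊗₁ id)) ∘ ((id ⊗₁ α⇐) ∘ α⇒) ∘ (id ⊗₁ h) ∘ (u B ⊗₁ id) ∘ λ⇐
      ≈⟨ pullˡ triangle′ ⟩
    (id ⊗₁ λ⇒) ∘ (id ⊗₁ (φ ⊗₁ id)) ∘ ((id ⊗₁ α⇐) ∘ α⇒) ∘ (id ⊗₁ h) ∘ (u B ⊗₁ id) ∘ λ⇐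
      ≈⟨ refl⟩∘⟨ refl⟩∘⟨ assoc ⟩
    (id ⊗₁ λ⇒) ∘ (id ⊗₁ (φ ⊗₁ id)) ∘ (id ⊗₁ α⇐) ∘ α⇒ ∘ (id ⊗₁ h) ∘ (u B ⊗₁ id) ∘ λ⇐
      ≈⟨ refl⟩∘⟨ refl⟩∘⟨ refl⟩∘⟨ refl⟩∘⟨ (⊗-identity ⟩⊗⟨ ≈.refl) ⟩∘⟨refl ⟨
    (id ⊗₁ λ⇒) ∘ (id ⊗₁ (φ ⊗₁ id)) ∘ (id ⊗₁ α⇐) ∘ α⇒ ∘ ((id ⊗₁ id) ⊗₁ h) ∘ (u B ⊗₁ id) ∘ λ⇐
      ≈⟨ refl⟩∘⟨ refl⟩∘⟨ refl⟩∘⟨ extendʳ α-natural ⟩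
    (id ⊗₁ λ⇒) ∘ (id ⊗₁ (φ ⊗₁ id)) ∘ (id ⊗₁ α⇐) ∘ (id ⊗₁ (id ⊗₁ h)) ∘ α⇒ ∘ (u B ⊗₁ id) ∘ λ⇐
      ≈⟨ refl⟩∘⟨ refl⟩∘⟨ refl⟩∘⟨ refl⟩∘⟨ refl⟩∘⟨ refl⟩∘⟨ kelly₃⇐ ⟩
    (id ⊗₁ λ⇒) ∘ (id ⊗₁ (φ ⊗₁ id)) ∘ (id ⊗₁ α⇐) ∘ (id ⊗₁ (id ⊗₁ h)) ∘ α⇒ ∘ (u B ⊗₁ id) ∘ ρ⇐
      ≈⟨ refl⟩∘⟨ refl⟩∘⟨ refl⟩∘⟨ refl⟩∘⟨ refl⟩∘⟨ ρ⇐-natural ⟩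
    (id ⊗₁ λ⇒) ∘ (id ⊗₁ (φ ⊗₁ id)) ∘ (id ⊗₁ α⇐) ∘ (id ⊗₁ (id ⊗₁ h)) ∘ α⇒ ∘ ρ⇐ ∘ u B
      ≈⟨ refl⟩∘⟨ refl⟩∘⟨ refl⟩∘⟨ refl⟩∘⟨ pushˡ id⊗ρ⇐ ⟨
    (id ⊗₁ λ⇒) ∘ (id ⊗₁ (φ ⊗₁ id)) ∘ (id ⊗₁ α⇐) ∘ (id ⊗₁ (id ⊗₁ h)) ∘ (id ⊗₁ ρ⇐) ∘ u B
      ≈⟨ ≈.trans (id⊗-split₅ ⟩∘⟨refl) assoc⁵ ⟨
    (id ⊗₁ (λ⇒ ∘ (φ ⊗₁ id) ∘ α⇐ ∘ (id ⊗₁ h) ∘ ρ⇐)) ∘ u B ∎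

  curryAlong-transport : ∀ {P P′ Q X} {k : Hom P P′} {κ : Hom I (P ⊗₀ Q)} {κ′ : Hom I (P′ ⊗₀ Q)} {φ : Hom (Q ⊗₀ X) I} →
    (k ⊗₁ id) ∘ κ ≈ κ′ → k ∘ curryAlong κ φ ≈ curryAlong κ′ φ
  curryAlong-transport {k = k} {κ} {κ′} {φ} h = begin
    k ∘ ρ⇒ ∘ (id ⊗₁ φ) ∘ α⇒ ∘ (κ ⊗₁ id) ∘ λ⇐ ≈⟨ extendʳ ρ-natural ⟨
    ρ⇒ ∘ (k ⊗₁ id) ∘ (id ⊗₁ φ) ∘ α⇒ ∘ (κ ⊗₁ id) ∘ λ⇐ ≈⟨ refl⟩∘⟨ extendʳ ⊗-interchange ⟩
    ρ⇒ ∘ (id ⊗₁ φ) ∘ (k ⊗₁ id) ∘ α⇒ ∘ (κ ⊗₁ id) ∘ λ⇐ ≈⟨ refl⟩∘⟨ refl⟩∘⟨ (≈.refl ⟩⊗⟨ ⊗-identity) ⟩∘⟨refl ⟨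
    ρ⇒ ∘ (id ⊗₁ φ) ∘ (k ⊗₁ (id ⊗₁ id)) ∘ α⇒ ∘ (κ ⊗₁ id) ∘ λ⇐ ≈⟨ refl⟩∘⟨ refl⟩∘⟨ extendʳ α-natural ⟨
    ρ⇒ ∘ (id ⊗₁ φ) ∘ α⇒ ∘ ((k ⊗₁ id) ⊗₁ id) ∘ (κ ⊗₁ id) ∘ λ⇐ ≈⟨ refl⟩∘⟨ refl⟩∘⟨ refl⟩∘⟨ pullˡ (≈.trans ⊗id∘⊗id (⊗id-resp-≈ h)) ⟩
    ρ⇒ ∘ (id ⊗₁ φ) ∘ α⇒ ∘ (κ′ ⊗₁ id) ∘ λ⇐ ∎

  -- The conventions A** = A, (A ⊗ B)* = B* ⊗ A* and I* = I

  cast-subst : ∀ {Z X Y} (p : X ≡ Y) (f : Hom Z X) → subst (Hom Z) p f ≈ cast 𝒞 p ∘ f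
  cast-subst refl _ = ≈.sym identityˡ

  cast-sym∘cast : ∀ {X Y} (p : X ≡ Y) → cast 𝒞 (sym p) ∘ cast 𝒞 p ≈ id
  cast-sym∘cast refl = identityˡ

  cast∘cast-sym : ∀ {X Y} (p : X ≡ Y) → cast 𝒞 p ∘ cast 𝒞 (sym p) ≈ id
  cast∘cast-sym refl = identityˡ

  cast-† : ∀ {X Y} (p : X ≡ Y) → cast 𝒞 p † ≈ cast 𝒞 (sym p)
  cast-† refl = †-identity

  cast-⊗ˡ : ∀ {X Y C} (p : X ≡ Y) → cast 𝒞 (cong (_⊗₀ C) p) ≈ cast 𝒞 p ⊗₁ id
  cast-⊗ˡ refl = ≈.sym ⊗-identity

  cast-sym-trans : ∀ {X Y Z} (p : X ≡ Y) (q : Y ≡ Z) → cast 𝒞 (sym (trans p q)) ≈ cast 𝒞 (sym p) ∘ cast 𝒞 (sym q)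
  cast-sym-trans refl refl = ≈.sym identityˡ

  cast-sym-cong⊗ʳ : ∀ {X Y C} (p : X ≡ Y) → cast 𝒞 (sym (cong (C ⊗₀_) p)) ≈ id ⊗₁ cast 𝒞 (sym p)
  cast-sym-cong⊗ʳ refl = ≈.sym ⊗-identity

  u†-transport : ∀ {X Y Z} (p : X ≡ Y) {v : Hom I (X ⊗₀ Z)} {v′ : Hom I (Y ⊗₀ Z)} →
    subst (Hom I) (cong (_⊗₀ Z) p) v ≈ v′ → v † ∘ (cast 𝒞 (sym p) ⊗₁ id) ≈ v′ †
  u†-transport p {v} {v′} h = begin
    v † ∘ (cast 𝒞 (sym p) ⊗₁ id) ≈⟨ refl⟩∘⟨ ≈.trans †⊗id (⊗id-resp-≈ (cast-† p)) ⟨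
    v † ∘ (cast 𝒞 p ⊗₁ id) † ≈⟨ †-homomorphism ⟨
    ((cast 𝒞 p ⊗₁ id) ∘ v) † ≈⟨ †-resp-≈ (cast-⊗ˡ p ⟩∘⟨refl) ⟨
    (cast 𝒞 (cong (_⊗₀ _) p) ∘ v) † ≈⟨ †-resp-≈ (cast-subst (cong (_⊗₀ _) p) v) ⟨
    subst (Hom I) (cong (_⊗₀ _) p) v † ≈⟨ †-resp-≈ h ⟩
    v′ † ∎

  counit-dual : ∀ A → c (A *) ∘ (id ⊗₁ cast 𝒞 (sym (dual-involutive A))) ≈ u A †
  counit-dual A = begin
    (u (A *) † ∘ σ) ∘ (id ⊗₁ cast 𝒞 (sym (dual-involutive A))) ≈⟨ assoc ⟩
    u (A *) † ∘ σ ∘ (id ⊗₁ cast 𝒞 (sym (dual-involutive A))) ≈⟨ refl⟩∘⟨ σ-natural ⟩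
    u (A *) † ∘ (cast 𝒞 (sym (dual-involutive A)) ⊗₁ id) ∘ σ ≈⟨ pullˡ (u†-transport (dual-involutive A) (u-dual A)) ⟩
    (σ ∘ u A) † ∘ σ ≈⟨ †-homomorphism ⟩∘⟨refl ⟩
    (u A † ∘ σ †) ∘ σ ≈⟨ ≈.trans assoc (elimʳ σ-unitaryˡ) ⟩
    u A † ∎

  counit-I : c I ∘ (id ⊗₁ cast 𝒞 (sym dual-I)) ≈ ρ⇒
  counit-I = begin
    (u I † ∘ σ) ∘ (id ⊗₁ cast 𝒞 (sym dual-I)) ≈⟨ assoc ⟩
    u I † ∘ σ ∘ (id ⊗₁ cast 𝒞 (sym dual-I)) ≈⟨ refl⟩∘⟨ σ-natural ⟩
    u I † ∘ (cast 𝒞 (sym dual-I) ⊗₁ id) ∘ σ ≈⟨ pullˡ (u†-transport dual-I u-I) ⟩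
    λ⇐ † ∘ σ ≈⟨ †-involutive ⟩∘⟨refl ⟩
    λ⇒ ∘ σ ≈⟨ λ∘σ≈ρ ⟩
    ρ⇒ ∎

  nestedCounit : ∀ X Y → Hom ((X ⊗₀ Y) ⊗₀ (Y * ⊗₀ X *)) I
  nestedCounit X Y = c X ∘ (id ⊗₁ λ⇒) ∘ (id ⊗₁ (c Y ⊗₁ id)) ∘ (id ⊗₁ α⇐) ∘ α⇒

  nestedUnit : ∀ X Y → Hom I ((Y * ⊗₀ X *) ⊗₀ (X ⊗₀ Y))
  nestedUnit X Y = α⇐ ∘ (id ⊗₁ α⇒) ∘ (id ⊗₁ (u X ⊗₁ id)) ∘ (id ⊗₁ λ⇐) ∘ u Y

  nested-snake-inner : ∀ {X Y} →
    ρ⇒ ∘ (id ⊗₁ nestedCounit X Y) ∘ α⇒ ∘ (α⇒ ⊗₁ id) ∘ ((u X ⊗₁ id) ⊗₁ id) ∘ (λ⇐ ⊗₁ id)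
    ≈ λ⇒ ∘ (c Y ⊗₁ id) ∘ α⇐
  nested-snake-inner {X} {Y} = begin
    ρ⇒ ∘ (id ⊗₁ nestedCounit X Y) ∘ α⇒ ∘ (α⇒ ⊗₁ id) ∘ ((u X ⊗₁ id) ⊗₁ id) ∘ (λ⇐ ⊗₁ id)
      ≈⟨ refl⟩∘⟨ ≈.trans (id⊗-split₅ ⟩∘⟨refl) assoc⁵ ⟩
    ρ⇒ ∘ (id ⊗₁ c X) ∘ (id ⊗₁ (id ⊗₁ λ⇒)) ∘ (id ⊗₁ (id ⊗₁ (c Y ⊗₁ id))) ∘ (id ⊗₁ (id ⊗₁ α⇐)) ∘ (id ⊗₁ α⇒)
      ∘ α⇒ ∘ (α⇒ ⊗₁ id) ∘ ((u X ⊗₁ id) ⊗₁ id) ∘ (λ⇐ ⊗₁ id)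
      ≈⟨ refl⟩∘⟨ refl⟩∘⟨ refl⟩∘⟨ refl⟩∘⟨ refl⟩∘⟨ extendʳ₃₂ pentagon ⟩
    ρ⇒ ∘ (id ⊗₁ c X) ∘ (id ⊗₁ (id ⊗₁ λ⇒)) ∘ (id ⊗₁ (id ⊗₁ (c Y ⊗₁ id))) ∘ (id ⊗₁ (id ⊗₁ α⇐))
      ∘ α⇒ ∘ α⇒ ∘ ((u X ⊗₁ id) ⊗₁ id) ∘ (λ⇐ ⊗₁ id)
      ≈⟨ refl⟩∘⟨ refl⟩∘⟨ refl⟩∘⟨ refl⟩∘⟨ extendʳ α-natural ⟨
    ρ⇒ ∘ (id ⊗₁ c X) ∘ (id ⊗₁ (id ⊗₁ λ⇒)) ∘ (id ⊗₁ (id ⊗₁ (c Y ⊗₁ id))) ∘ α⇒ ∘ ((id ⊗₁ id) ⊗₁ α⇐)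
      ∘ α⇒ ∘ ((u X ⊗₁ id) ⊗₁ id) ∘ (λ⇐ ⊗₁ id)
      ≈⟨ refl⟩∘⟨ refl⟩∘⟨ refl⟩∘⟨ extendʳ α-natural ⟨
    ρ⇒ ∘ (id ⊗₁ c X) ∘ (id ⊗₁ (id ⊗₁ λ⇒)) ∘ α⇒ ∘ ((id ⊗₁ id) ⊗₁ (c Y ⊗₁ id)) ∘ ((id ⊗₁ id) ⊗₁ α⇐)
      ∘ α⇒ ∘ ((u X ⊗₁ id) ⊗₁ id) ∘ (λ⇐ ⊗₁ id)
      ≈⟨ refl⟩∘⟨ refl⟩∘⟨ extendʳ α-natural ⟨
    ρ⇒ ∘ (id ⊗₁ c X) ∘ α⇒ ∘ ((id ⊗₁ id) ⊗₁ λ⇒) ∘ ((id ⊗₁ id) ⊗₁ (c Y ⊗₁ id)) ∘ ((id ⊗₁ id) ⊗₁ α⇐)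
      ∘ α⇒ ∘ ((u X ⊗₁ id) ⊗₁ id) ∘ (λ⇐ ⊗₁ id)
      ≈⟨ refl⟩∘⟨ refl⟩∘⟨ refl⟩∘⟨ refl⟩∘⟨ refl⟩∘⟨ refl⟩∘⟨ extendʳ α-natural ⟩
    ρ⇒ ∘ (id ⊗₁ c X) ∘ α⇒ ∘ ((id ⊗₁ id) ⊗₁ λ⇒) ∘ ((id ⊗₁ id) ⊗₁ (c Y ⊗₁ id)) ∘ ((id ⊗₁ id) ⊗₁ α⇐)
      ∘ (u X ⊗₁ (id ⊗₁ id)) ∘ α⇒ ∘ (λ⇐ ⊗₁ id)
      ≈⟨ refl⟩∘⟨ refl⟩∘⟨ refl⟩∘⟨ refl⟩∘⟨ refl⟩∘⟨ refl⟩∘⟨ refl⟩∘⟨ kelly₁⇐ ⟩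
    ρ⇒ ∘ (id ⊗₁ c X) ∘ α⇒ ∘ ((id ⊗₁ id) ⊗₁ λ⇒) ∘ ((id ⊗₁ id) ⊗₁ (c Y ⊗₁ id)) ∘ ((id ⊗₁ id) ⊗₁ α⇐)
      ∘ (u X ⊗₁ (id ⊗₁ id)) ∘ λ⇐
      ≈⟨ refl⟩∘⟨ refl⟩∘⟨ refl⟩∘⟨ (⊗-identity ⟩⊗⟨ ≈.refl) ⟩∘⟨ (⊗-identity ⟩⊗⟨ ≈.refl) ⟩∘⟨ (⊗-identity ⟩⊗⟨ ≈.refl) ⟩∘⟨ (≈.refl ⟩⊗⟨ ⊗-identity) ⟩∘⟨ ≈.refl ⟩
    ρ⇒ ∘ (id ⊗₁ c X) ∘ α⇒ ∘ (id ⊗₁ λ⇒) ∘ (id ⊗₁ (c Y ⊗₁ id)) ∘ (id ⊗₁ α⇐) ∘ (u X ⊗₁ id) ∘ λ⇐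
      ≈⟨ refl⟩∘⟨ refl⟩∘⟨ refl⟩∘⟨ ≈.trans (id⊗-split₃ ⟩∘⟨refl) (≈.trans assoc (refl⟩∘⟨ assoc)) ⟨
    ρ⇒ ∘ (id ⊗₁ c X) ∘ α⇒ ∘ (id ⊗₁ (λ⇒ ∘ (c Y ⊗₁ id) ∘ α⇐)) ∘ (u X ⊗₁ id) ∘ λ⇐
      ≈⟨ refl⟩∘⟨ refl⟩∘⟨ refl⟩∘⟨ extendʳ ⊗-interchange˘ ⟩
    ρ⇒ ∘ (id ⊗₁ c X) ∘ α⇒ ∘ (u X ⊗₁ id) ∘ (id ⊗₁ (λ⇒ ∘ (c Y ⊗₁ id) ∘ α⇐)) ∘ λ⇐
      ≈⟨ refl⟩∘⟨ refl⟩∘⟨ refl⟩∘⟨ refl⟩∘⟨ λ⇐-natural ⟩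
    ρ⇒ ∘ (id ⊗₁ c X) ∘ α⇒ ∘ (u X ⊗₁ id) ∘ λ⇐ ∘ (λ⇒ ∘ (c Y ⊗₁ id) ∘ α⇐)
      ≈⟨ assoc⁵ ⟨
    (ρ⇒ ∘ (id ⊗₁ c X) ∘ α⇒ ∘ (u X ⊗₁ id) ∘ λ⇐) ∘ (λ⇒ ∘ (c Y ⊗₁ id) ∘ α⇐)
      ≈⟨ elimˡ snake₂ ⟩
    λ⇒ ∘ (c Y ⊗₁ id) ∘ α⇐ ∎

  nested-snake : ∀ {X Y} → curryAlong (nestedUnit X Y) (nestedCounit X Y) ≈ id
  nested-snake {X} {Y} = begin
    ρ⇒ ∘ (id ⊗₁ nestedCounit X Y) ∘ α⇒ ∘ (nestedUnit X Y ⊗₁ id) ∘ λ⇐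
      ≈⟨ refl⟩∘⟨ refl⟩∘⟨ refl⟩∘⟨ ≈.trans (⊗id-split₅ ⟩∘⟨refl) assoc⁵ ⟩
    ρ⇒ ∘ (id ⊗₁ nestedCounit X Y) ∘ α⇒ ∘ (α⇐ ⊗₁ id) ∘ ((id ⊗₁ α⇒) ⊗₁ id) ∘ ((id ⊗₁ (u X ⊗₁ id)) ⊗₁ id)
      ∘ ((id ⊗₁ λ⇐) ⊗₁ id) ∘ (u Y ⊗₁ id) ∘ λ⇐
      ≈⟨ refl⟩∘⟨ refl⟩∘⟨ extendʳ₂₃ (≈.sym pentagon-α⇐∘id⊗α) ⟩
    ρ⇒ ∘ (id ⊗₁ nestedCounit X Y) ∘ α⇐ ∘ (id ⊗₁ α⇒) ∘ α⇒ ∘ ((id ⊗₁ α⇒) ⊗₁ id) ∘ ((id ⊗₁ (u X ⊗₁ id)) ⊗₁ id)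
      ∘ ((id ⊗₁ λ⇐) ⊗₁ id) ∘ (u Y ⊗₁ id) ∘ λ⇐
      ≈⟨ refl⟩∘⟨ refl⟩∘⟨ refl⟩∘⟨ refl⟩∘⟨ extendʳ α-natural ⟩
    ρ⇒ ∘ (id ⊗₁ nestedCounit X Y) ∘ α⇐ ∘ (id ⊗₁ α⇒) ∘ (id ⊗₁ (α⇒ ⊗₁ id)) ∘ α⇒ ∘ ((id ⊗₁ (u X ⊗₁ id)) ⊗₁ id)
      ∘ ((id ⊗₁ λ⇐) ⊗₁ id) ∘ (u Y ⊗₁ id) ∘ λ⇐
      ≈⟨ refl⟩∘⟨ refl⟩∘⟨ refl⟩∘⟨ refl⟩∘⟨ refl⟩∘⟨ extendʳ α-natural ⟩
    ρ⇒ ∘ (id ⊗₁ nestedCounit X Y) ∘ α⇐ ∘ (id ⊗₁ α⇒) ∘ (id ⊗₁ (α⇒ ⊗₁ id)) ∘ (id ⊗₁ ((u X ⊗₁ id) ⊗₁ id)) ∘ α⇒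
      ∘ ((id ⊗₁ λ⇐) ⊗₁ id) ∘ (u Y ⊗₁ id) ∘ λ⇐
      ≈⟨ refl⟩∘⟨ refl⟩∘⟨ refl⟩∘⟨ refl⟩∘⟨ refl⟩∘⟨ refl⟩∘⟨ extendʳ α-natural ⟩
    ρ⇒ ∘ (id ⊗₁ nestedCounit X Y) ∘ α⇐ ∘ (id ⊗₁ α⇒) ∘ (id ⊗₁ (α⇒ ⊗₁ id)) ∘ (id ⊗₁ ((u X ⊗₁ id) ⊗₁ id))
      ∘ (id ⊗₁ (λ⇐ ⊗₁ id)) ∘ α⇒ ∘ (u Y ⊗₁ id) ∘ λ⇐
      ≈⟨ refl⟩∘⟨ (⊗-identity ⟩⊗⟨ ≈.refl) ⟩∘⟨refl ⟨
    ρ⇒ ∘ ((id ⊗₁ id) ⊗₁ nestedCounit X Y) ∘ α⇐ ∘ (id ⊗₁ α⇒) ∘ (id ⊗₁ (α⇒ ⊗₁ id)) ∘ (id ⊗₁ ((u X ⊗₁ id) ⊗₁ id))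
      ∘ (id ⊗₁ (λ⇐ ⊗₁ id)) ∘ α⇒ ∘ (u Y ⊗₁ id) ∘ λ⇐
      ≈⟨ refl⟩∘⟨ extendʳ α⇐-natural ⟨
    ρ⇒ ∘ α⇐ ∘ (id ⊗₁ (id ⊗₁ nestedCounit X Y)) ∘ (id ⊗₁ α⇒) ∘ (id ⊗₁ (α⇒ ⊗₁ id)) ∘ (id ⊗₁ ((u X ⊗₁ id) ⊗₁ id))
      ∘ (id ⊗₁ (λ⇐ ⊗₁ id)) ∘ α⇒ ∘ (u Y ⊗₁ id) ∘ λ⇐
      ≈⟨ pullˡ (≈.sym kelly₂′) ⟩
    (id ⊗₁ ρ⇒) ∘ (id ⊗₁ (id ⊗₁ nestedCounit X Y)) ∘ (id ⊗₁ α⇒) ∘ (id ⊗₁ (α⇒ ⊗₁ id)) ∘ (id ⊗₁ ((u X ⊗₁ id) ⊗₁ id))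
      ∘ (id ⊗₁ (λ⇐ ⊗₁ id)) ∘ α⇒ ∘ (u Y ⊗₁ id) ∘ λ⇐
      ≈⟨ ≈.trans (id⊗-split₆ ⟩∘⟨refl) assoc⁶ ⟨
    (id ⊗₁ (ρ⇒ ∘ (id ⊗₁ nestedCounit X Y) ∘ α⇒ ∘ (α⇒ ⊗₁ id) ∘ ((u X ⊗₁ id) ⊗₁ id) ∘ (λ⇐ ⊗₁ id))) ∘ α⇒ ∘ (u Y ⊗₁ id) ∘ λ⇐
      ≈⟨ id⊗-resp-≈ nested-snake-inner ⟩∘⟨refl ⟩
    (id ⊗₁ (λ⇒ ∘ (c Y ⊗₁ id) ∘ α⇐)) ∘ α⇒ ∘ (u Y ⊗₁ id) ∘ λ⇐
      ≈⟨ ≈.trans (id⊗-split₃ ⟩∘⟨refl) (≈.trans assoc (refl⟩∘⟨ assoc)) ⟩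
    (id ⊗₁ λ⇒) ∘ (id ⊗₁ (c Y ⊗₁ id)) ∘ (id ⊗₁ α⇐) ∘ α⇒ ∘ (u Y ⊗₁ id) ∘ λ⇐
      ≈⟨ snake₂⊗ ⟩
    id ∎

  counit-⊗≈nestedCounit : ∀ X Y → uncurry (X ⊗₀ Y) (cast 𝒞 (sym (dual-⊗ X Y))) ≈ nestedCounit X Y
  counit-⊗≈nestedCounit X Y = uncurry-≈ (begin
    cast 𝒞 (sym Q) ≈⟨ identityʳ ⟨
    cast 𝒞 (sym Q) ∘ id ≈⟨ refl⟩∘⟨ nested-snake ⟨
    cast 𝒞 (sym Q) ∘ curryAlong (nestedUnit X Y) (nestedCounit X Y) ≈⟨ refl⟩∘⟨ curryAlong-transport cu ⟨
    cast 𝒞 (sym Q) ∘ cast 𝒞 Q ∘ curry (X ⊗₀ Y) (nestedCounit X Y) ≈⟨ cancelˡ (cast-sym∘cast Q) ⟩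
    curry (X ⊗₀ Y) (nestedCounit X Y) ∎)
    where
      Q : (X ⊗₀ Y) * ≡ Y * ⊗₀ X *
      Q = dual-⊗ X Y
      cu : (cast 𝒞 Q ⊗₁ id) ∘ u (X ⊗₀ Y) ≈ nestedUnit X Y
      cu = ≈.trans (≈.sym (cast-⊗ˡ Q) ⟩∘⟨refl) (≈.trans (≈.sym (cast-subst (cong (_⊗₀ (X ⊗₀ Y)) Q) (u (X ⊗₀ Y)))) (u-⊗ X Y))

  pantsMult∘id⊗ : ∀ {A Z} {g : Hom Z (A * ⊗₀ A)} → pantsMult 𝒞 A ∘ (id ⊗₁ g) ≈ (id ⊗₁ unbend A g) ∘ α⇒
  pantsMult∘id⊗ {A} {g = g} = begin
    ((id ⊗₁ λ⇒) ∘ (id ⊗₁ (c A ⊗₁ id)) ∘ (id ⊗₁ α⇐) ∘ α⇒) ∘ (id ⊗₁ g) ≈⟨ assoc⁴ ⟩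
    (id ⊗₁ λ⇒) ∘ (id ⊗₁ (c A ⊗₁ id)) ∘ (id ⊗₁ α⇐) ∘ α⇒ ∘ (id ⊗₁ g) ≈⟨ refl⟩∘⟨ refl⟩∘⟨ refl⟩∘⟨ refl⟩∘⟨ (⊗-identity ⟩⊗⟨ ≈.refl) ⟨
    (id ⊗₁ λ⇒) ∘ (id ⊗₁ (c A ⊗₁ id)) ∘ (id ⊗₁ α⇐) ∘ α⇒ ∘ ((id ⊗₁ id) ⊗₁ g) ≈⟨ refl⟩∘⟨ refl⟩∘⟨ refl⟩∘⟨ α-natural ⟩
    (id ⊗₁ λ⇒) ∘ (id ⊗₁ (c A ⊗₁ id)) ∘ (id ⊗₁ α⇐) ∘ (id ⊗₁ (id ⊗₁ g)) ∘ α⇒ ≈⟨ ≈.trans (id⊗-split₄ ⟩∘⟨refl) assoc⁴ ⟨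
    (id ⊗₁ unbend A g) ∘ α⇒ ∎

  uncurry-pantsInv : ∀ {A} → uncurry (A * ⊗₀ A) (pantsInv 𝒞 A) ≈ u A † ∘ (id ⊗₁ (λ⇒ ∘ (c A ⊗₁ id) ∘ α⇐)) ∘ α⇒
  uncurry-pantsInv {A} = begin
    uncurry (A * ⊗₀ A) (cast 𝒞 (sym (pants-dual 𝒞 A))) ≈⟨ uncurry-resp-≈ (≈.trans (cast-sym-trans Q Pr) (refl⟩∘⟨ cast-sym-cong⊗ʳ P)) ⟩
    uncurry (A * ⊗₀ A) (cast 𝒞 (sym Q) ∘ (id ⊗₁ k)) ≈⟨ uncurry-∘ ⟩
    uncurry (A * ⊗₀ A) (cast 𝒞 (sym Q)) ∘ (id ⊗₁ (id ⊗₁ k)) ≈⟨ counit-⊗≈nestedCounit (A *) A ⟩∘⟨refl ⟩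
    nestedCounit (A *) A ∘ (id ⊗₁ (id ⊗₁ k)) ≈⟨ nestedCounit-dual-cast ⟩
    u A † ∘ (id ⊗₁ (λ⇒ ∘ (c A ⊗₁ id) ∘ α⇐)) ∘ α⇒ ∎
    where
      P : (A *) * ≡ A
      P = dual-involutive A
      Q : (A * ⊗₀ A) * ≡ A * ⊗₀ (A *) *
      Q = dual-⊗ (A *) A
      Pr : A * ⊗₀ (A *) * ≡ A * ⊗₀ A
      Pr = cong (A * ⊗₀_) P
      k : Hom A ((A *) *)
      k = cast 𝒞 (sym P)
      nestedCounit-dual-cast : nestedCounit (A *) A ∘ (id ⊗₁ (id ⊗₁ k)) ≈ u A † ∘ (id ⊗₁ (λ⇒ ∘ (c A ⊗₁ id) ∘ α⇐)) ∘ α⇒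
      nestedCounit-dual-cast = begin
        (c (A *) ∘ (id ⊗₁ λ⇒) ∘ (id ⊗₁ (c A ⊗₁ id)) ∘ (id ⊗₁ α⇐) ∘ α⇒) ∘ (id ⊗₁ (id ⊗₁ k)) ≈⟨ assoc⁵ ⟩
        c (A *) ∘ (id ⊗₁ λ⇒) ∘ (id ⊗₁ (c A ⊗₁ id)) ∘ (id ⊗₁ α⇐) ∘ α⇒ ∘ (id ⊗₁ (id ⊗₁ k))
          ≈⟨ refl⟩∘⟨ refl⟩∘⟨ refl⟩∘⟨ refl⟩∘⟨ refl⟩∘⟨ (⊗-identity ⟩⊗⟨ ≈.refl) ⟨
        c (A *) ∘ (id ⊗₁ λ⇒) ∘ (id ⊗₁ (c A ⊗₁ id)) ∘ (id ⊗₁ α⇐) ∘ α⇒ ∘ ((id ⊗₁ id) ⊗₁ (id ⊗₁ k))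
          ≈⟨ refl⟩∘⟨ refl⟩∘⟨ refl⟩∘⟨ refl⟩∘⟨ α-natural ⟩
        c (A *) ∘ (id ⊗₁ λ⇒) ∘ (id ⊗₁ (c A ⊗₁ id)) ∘ (id ⊗₁ α⇐) ∘ (id ⊗₁ (id ⊗₁ (id ⊗₁ k))) ∘ α⇒
          ≈⟨ refl⟩∘⟨ ≈.trans (id⊗-split₄ ⟩∘⟨refl) assoc⁴ ⟨
        c (A *) ∘ (id ⊗₁ (λ⇒ ∘ (c A ⊗₁ id) ∘ α⇐ ∘ (id ⊗₁ (id ⊗₁ k)))) ∘ α⇒ ≈⟨ refl⟩∘⟨ id⊗-resp-≈ contract-id⊗k ⟩∘⟨refl ⟩
        c (A *) ∘ (id ⊗₁ (k ∘ λ⇒ ∘ (c A ⊗₁ id) ∘ α⇐)) ∘ α⇒ ≈⟨ refl⟩∘⟨ pushˡ id⊗-split ⟩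
        c (A *) ∘ (id ⊗₁ k) ∘ (id ⊗₁ (λ⇒ ∘ (c A ⊗₁ id) ∘ α⇐)) ∘ α⇒ ≈⟨ pullˡ (counit-dual A) ⟩
        u A † ∘ (id ⊗₁ (λ⇒ ∘ (c A ⊗₁ id) ∘ α⇐)) ∘ α⇒ ∎
        where
          contract-id⊗k : λ⇒ ∘ (c A ⊗₁ id) ∘ α⇐ ∘ (id ⊗₁ (id ⊗₁ k)) ≈ k ∘ λ⇒ ∘ (c A ⊗₁ id) ∘ α⇐
          contract-id⊗k = begin
            λ⇒ ∘ (c A ⊗₁ id) ∘ α⇐ ∘ (id ⊗₁ (id ⊗₁ k)) ≈⟨ refl⟩∘⟨ refl⟩∘⟨ α⇐-natural ⟩
            λ⇒ ∘ (c A ⊗₁ id) ∘ ((id ⊗₁ id) ⊗₁ k) ∘ α⇐ ≈⟨ refl⟩∘⟨ extendʳ (≈.trans (refl⟩∘⟨ (⊗-identity ⟩⊗⟨ ≈.refl)) ⊗-interchange) ⟩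
            λ⇒ ∘ (id ⊗₁ k) ∘ (c A ⊗₁ id) ∘ α⇐ ≈⟨ extendʳ λ-natural ⟩
            k ∘ λ⇒ ∘ (c A ⊗₁ id) ∘ α⇐ ∎

  module Frobenius {A : Obj} (M : Monoid 𝒞 A) where
    open Monoid M renaming (mult to m; unit to eₘ)

    pairing : Hom (A ⊗₀ A) I
    pairing = eₘ † ∘ m

    copairing : Hom I (A ⊗₀ A)
    copairing = m † ∘ eₘ

    pairingMult : Hom (A ⊗₀ A) A
    pairingMult = ρ⇒ ∘ (id ⊗₁ pairing) ∘ α⇒ ∘ (m † ⊗₁ id)

    rightMul : ∀ {W} → Hom I (A ⊗₀ W) → Hom A (A ⊗₀ W)
    rightMul v = (m ⊗₁ id) ∘ α⇐ ∘ (id ⊗₁ v) ∘ ρ⇐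

    leftMul : ∀ {W} → Hom I (W ⊗₀ A) → Hom A (W ⊗₀ A)
    leftMul v = (id ⊗₁ m) ∘ α⇒ ∘ (v ⊗₁ id) ∘ λ⇐

    mult-assoc′ : m ∘ (id ⊗₁ m) ≈ m ∘ (m ⊗₁ id) ∘ α⇐
    mult-assoc′ = begin
      m ∘ (id ⊗₁ m) ≈⟨ refl⟩∘⟨ elimʳ α-unitaryʳ ⟨
      m ∘ (id ⊗₁ m) ∘ α⇒ ∘ α⇐ ≈⟨ ≈.trans (refl⟩∘⟨ sym-assoc) sym-assoc ⟩
      (m ∘ (id ⊗₁ m) ∘ α⇒) ∘ α⇐ ≈⟨ mult-assoc ⟩∘⟨refl ⟨
      (m ∘ (m ⊗₁ id)) ∘ α⇐ ≈⟨ assoc ⟩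
      m ∘ (m ⊗₁ id) ∘ α⇐ ∎

    pairing-assoc : pairing ∘ (id ⊗₁ m) ≈ pairing ∘ (m ⊗₁ id) ∘ α⇐
    pairing-assoc = ≈.trans assoc (≈.trans (refl⟩∘⟨ mult-assoc′) sym-assoc)

    pairing† : pairing † ≈ copairing
    pairing† = ≈.trans †-homomorphism (refl⟩∘⟨ †-involutive)

    copairing† : copairing † ≈ pairing
    copairing† = ≈.trans †-homomorphism (refl⟩∘⟨ †-involutive)

    unit-right† : (id ⊗₁ eₘ †) ∘ m † ≈ ρ⇐
    unit-right† = ≈.trans (≈.sym id⊗† ⟩∘⟨refl) (≈.trans (≈.sym †-homomorphism) (†-resp-≈ unit-right))

    unit-left† : (eₘ † ⊗₁ id) ∘ m † ≈ λ⇐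
    unit-left† = ≈.trans (≈.sym †⊗id ⟩∘⟨refl) (≈.trans (≈.sym †-homomorphism) (†-resp-≈ unit-left))

    pairingMult≈mult : IsFrobenius 𝒞 M → pairingMult ≈ m
    pairingMult≈mult fr = begin
      ρ⇒ ∘ (id ⊗₁ (eₘ † ∘ m)) ∘ α⇒ ∘ (m † ⊗₁ id) ≈⟨ refl⟩∘⟨ pushˡ id⊗-split ⟩
      ρ⇒ ∘ (id ⊗₁ eₘ †) ∘ (id ⊗₁ m) ∘ α⇒ ∘ (m † ⊗₁ id) ≈⟨ refl⟩∘⟨ refl⟩∘⟨ fr ⟩
      ρ⇒ ∘ (id ⊗₁ eₘ †) ∘ (m ⊗₁ id) ∘ α⇐ ∘ (id ⊗₁ m †) ≈⟨ refl⟩∘⟨ extendʳ ⊗-interchange˘ ⟩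
      ρ⇒ ∘ (m ⊗₁ id) ∘ (id ⊗₁ eₘ †) ∘ α⇐ ∘ (id ⊗₁ m †) ≈⟨ extendʳ ρ-natural ⟩
      m ∘ ρ⇒ ∘ (id ⊗₁ eₘ †) ∘ α⇐ ∘ (id ⊗₁ m †) ≈⟨ refl⟩∘⟨ refl⟩∘⟨ (⊗-identity ⟩⊗⟨ ≈.refl) ⟩∘⟨refl ⟨
      m ∘ ρ⇒ ∘ ((id ⊗₁ id) ⊗₁ eₘ †) ∘ α⇐ ∘ (id ⊗₁ m †) ≈⟨ refl⟩∘⟨ refl⟩∘⟨ extendʳ α⇐-natural ⟨
      m ∘ ρ⇒ ∘ α⇐ ∘ (id ⊗₁ (id ⊗₁ eₘ †)) ∘ (id ⊗₁ m †) ≈⟨ refl⟩∘⟨ refl⟩∘⟨ refl⟩∘⟨ ≈.trans id⊗∘id⊗ (id⊗-resp-≈ unit-right†) ⟩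
      m ∘ ρ⇒ ∘ α⇐ ∘ (id ⊗₁ ρ⇐) ≈⟨ refl⟩∘⟨ refl⟩∘⟨ kelly₂⇐ ⟩
      m ∘ ρ⇒ ∘ ρ⇐ ≈⟨ elimʳ ρ-unitaryʳ ⟩
      m ∎

    rightMul-linear : ∀ {Z W} {φ : Hom (A ⊗₀ A) Z} {v : Hom I (A ⊗₀ W)} → φ ∘ (id ⊗₁ m) ≈ φ ∘ (m ⊗₁ id) ∘ α⇐ →
      (φ ⊗₁ id) ∘ α⇐ ∘ (id ⊗₁ rightMul v) ≈ (φ ⊗₁ id) ∘ α⇐ ∘ (id ⊗₁ v) ∘ ρ⇐ ∘ m
    rightMul-linear {φ = φ} {v} hyp = begin
      (φ ⊗₁ id) ∘ α⇐ ∘ (id ⊗₁ ((m ⊗₁ id) ∘ α⇐ ∘ (id ⊗₁ v) ∘ ρ⇐)) ≈⟨ refl⟩∘⟨ refl⟩∘⟨ id⊗-split₄ ⟩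
      (φ ⊗₁ id) ∘ α⇐ ∘ (id ⊗₁ (m ⊗₁ id)) ∘ (id ⊗₁ α⇐) ∘ (id ⊗₁ (id ⊗₁ v)) ∘ (id ⊗₁ ρ⇐) ≈⟨ refl⟩∘⟨ extendʳ α⇐-natural ⟩
      (φ ⊗₁ id) ∘ ((id ⊗₁ m) ⊗₁ id) ∘ α⇐ ∘ (id ⊗₁ α⇐) ∘ (id ⊗₁ (id ⊗₁ v)) ∘ (id ⊗₁ ρ⇐) ≈⟨ pullˡ ⊗id∘⊗id ⟩
      ((φ ∘ (id ⊗₁ m)) ⊗₁ id) ∘ α⇐ ∘ (id ⊗₁ α⇐) ∘ (id ⊗₁ (id ⊗₁ v)) ∘ (id ⊗₁ ρ⇐) ≈⟨ ⊗id-resp-≈ hyp ⟩∘⟨refl ⟩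
      ((φ ∘ (m ⊗₁ id) ∘ α⇐) ⊗₁ id) ∘ α⇐ ∘ (id ⊗₁ α⇐) ∘ (id ⊗₁ (id ⊗₁ v)) ∘ (id ⊗₁ ρ⇐) ≈⟨ ≈.trans (pushˡ ⊗id-split₃) (refl⟩∘⟨ assoc) ⟩
      (φ ⊗₁ id) ∘ ((m ⊗₁ id) ⊗₁ id) ∘ (α⇐ ⊗₁ id) ∘ α⇐ ∘ (id ⊗₁ α⇐) ∘ (id ⊗₁ (id ⊗₁ v)) ∘ (id ⊗₁ ρ⇐)
        ≈⟨ refl⟩∘⟨ refl⟩∘⟨ extendʳ₃₂ pentagon⇐ ⟩
      (φ ⊗₁ id) ∘ ((m ⊗₁ id) ⊗₁ id) ∘ α⇐ ∘ α⇐ ∘ (id ⊗₁ (id ⊗₁ v)) ∘ (id ⊗₁ ρ⇐) ≈⟨ refl⟩∘⟨ refl⟩∘⟨ refl⟩∘⟨ extendʳ α⇐-natural ⟩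
      (φ ⊗₁ id) ∘ ((m ⊗₁ id) ⊗₁ id) ∘ α⇐ ∘ ((id ⊗₁ id) ⊗₁ v) ∘ α⇐ ∘ (id ⊗₁ ρ⇐) ≈⟨ refl⟩∘⟨ refl⟩∘⟨ refl⟩∘⟨ (⊗-identity ⟩⊗⟨ ≈.refl) ⟩∘⟨refl ⟩
      (φ ⊗₁ id) ∘ ((m ⊗₁ id) ⊗₁ id) ∘ α⇐ ∘ (id ⊗₁ v) ∘ α⇐ ∘ (id ⊗₁ ρ⇐) ≈⟨ refl⟩∘⟨ extendʳ α⇐-natural ⟨
      (φ ⊗₁ id) ∘ α⇐ ∘ (m ⊗₁ (id ⊗₁ id)) ∘ (id ⊗₁ v) ∘ α⇐ ∘ (id ⊗₁ ρ⇐) ≈⟨ refl⟩∘⟨ refl⟩∘⟨ (≈.refl ⟩⊗⟨ ⊗-identity) ⟩∘⟨refl ⟩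
      (φ ⊗₁ id) ∘ α⇐ ∘ (m ⊗₁ id) ∘ (id ⊗₁ v) ∘ α⇐ ∘ (id ⊗₁ ρ⇐) ≈⟨ refl⟩∘⟨ refl⟩∘⟨ extendʳ ⊗-interchange ⟩
      (φ ⊗₁ id) ∘ α⇐ ∘ (id ⊗₁ v) ∘ (m ⊗₁ id) ∘ α⇐ ∘ (id ⊗₁ ρ⇐) ≈⟨ refl⟩∘⟨ refl⟩∘⟨ refl⟩∘⟨ refl⟩∘⟨ kelly₂⇐ ⟩
      (φ ⊗₁ id) ∘ α⇐ ∘ (id ⊗₁ v) ∘ (m ⊗₁ id) ∘ ρ⇐ ≈⟨ refl⟩∘⟨ refl⟩∘⟨ refl⟩∘⟨ ρ⇐-natural ⟩
      (φ ⊗₁ id) ∘ α⇐ ∘ (id ⊗₁ v) ∘ ρ⇐ ∘ m ∎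

    leftMul-linear : ∀ {Z W} {φ : Hom (A ⊗₀ A) Z} {v : Hom I (W ⊗₀ A)} → φ ∘ (m ⊗₁ id) ≈ φ ∘ (id ⊗₁ m) ∘ α⇒ →
      (id ⊗₁ φ) ∘ α⇒ ∘ (leftMul v ⊗₁ id) ≈ (id ⊗₁ φ) ∘ α⇒ ∘ (v ⊗₁ id) ∘ λ⇐ ∘ m
    leftMul-linear {φ = φ} {v} hyp = begin
      (id ⊗₁ φ) ∘ α⇒ ∘ (((id ⊗₁ m) ∘ α⇒ ∘ (v ⊗₁ id) ∘ λ⇐) ⊗₁ id) ≈⟨ refl⟩∘⟨ refl⟩∘⟨ ⊗id-split₄ ⟩
      (id ⊗₁ φ) ∘ α⇒ ∘ ((id ⊗₁ m) ⊗₁ id) ∘ (α⇒ ⊗₁ id) ∘ ((v ⊗₁ id) ⊗₁ id) ∘ (λ⇐ ⊗₁ id) ≈⟨ refl⟩∘⟨ extendʳ α-natural ⟩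
      (id ⊗₁ φ) ∘ (id ⊗₁ (m ⊗₁ id)) ∘ α⇒ ∘ (α⇒ ⊗₁ id) ∘ ((v ⊗₁ id) ⊗₁ id) ∘ (λ⇐ ⊗₁ id) ≈⟨ pullˡ id⊗∘id⊗ ⟩
      (id ⊗₁ (φ ∘ (m ⊗₁ id))) ∘ α⇒ ∘ (α⇒ ⊗₁ id) ∘ ((v ⊗₁ id) ⊗₁ id) ∘ (λ⇐ ⊗₁ id) ≈⟨ id⊗-resp-≈ hyp ⟩∘⟨refl ⟩
      (id ⊗₁ (φ ∘ (id ⊗₁ m) ∘ α⇒)) ∘ α⇒ ∘ (α⇒ ⊗₁ id) ∘ ((v ⊗₁ id) ⊗₁ id) ∘ (λ⇐ ⊗₁ id) ≈⟨ ≈.trans (pushˡ id⊗-split₃) (refl⟩∘⟨ assoc) ⟩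
      (id ⊗₁ φ) ∘ (id ⊗₁ (id ⊗₁ m)) ∘ (id ⊗₁ α⇒) ∘ α⇒ ∘ (α⇒ ⊗₁ id) ∘ ((v ⊗₁ id) ⊗₁ id) ∘ (λ⇐ ⊗₁ id)
        ≈⟨ refl⟩∘⟨ refl⟩∘⟨ extendʳ₃₂ pentagon ⟩
      (id ⊗₁ φ) ∘ (id ⊗₁ (id ⊗₁ m)) ∘ α⇒ ∘ α⇒ ∘ ((v ⊗₁ id) ⊗₁ id) ∘ (λ⇐ ⊗₁ id) ≈⟨ refl⟩∘⟨ refl⟩∘⟨ refl⟩∘⟨ extendʳ α-natural ⟩
      (id ⊗₁ φ) ∘ (id ⊗₁ (id ⊗₁ m)) ∘ α⇒ ∘ (v ⊗₁ (id ⊗₁ id)) ∘ α⇒ ∘ (λ⇐ ⊗₁ id) ≈⟨ refl⟩∘⟨ refl⟩∘⟨ refl⟩∘⟨ (≈.refl ⟩⊗⟨ ⊗-identity) ⟩∘⟨refl ⟩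
      (id ⊗₁ φ) ∘ (id ⊗₁ (id ⊗₁ m)) ∘ α⇒ ∘ (v ⊗₁ id) ∘ α⇒ ∘ (λ⇐ ⊗₁ id) ≈⟨ refl⟩∘⟨ extendʳ α-natural ⟨
      (id ⊗₁ φ) ∘ α⇒ ∘ ((id ⊗₁ id) ⊗₁ m) ∘ (v ⊗₁ id) ∘ α⇒ ∘ (λ⇐ ⊗₁ id) ≈⟨ refl⟩∘⟨ refl⟩∘⟨ (⊗-identity ⟩⊗⟨ ≈.refl) ⟩∘⟨refl ⟩
      (id ⊗₁ φ) ∘ α⇒ ∘ (id ⊗₁ m) ∘ (v ⊗₁ id) ∘ α⇒ ∘ (λ⇐ ⊗₁ id) ≈⟨ refl⟩∘⟨ refl⟩∘⟨ extendʳ ⊗-interchange˘ ⟩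
      (id ⊗₁ φ) ∘ α⇒ ∘ (v ⊗₁ id) ∘ (id ⊗₁ m) ∘ α⇒ ∘ (λ⇐ ⊗₁ id) ≈⟨ refl⟩∘⟨ refl⟩∘⟨ refl⟩∘⟨ refl⟩∘⟨ kelly₁⇐ ⟩
      (id ⊗₁ φ) ∘ α⇒ ∘ (v ⊗₁ id) ∘ (id ⊗₁ m) ∘ λ⇐ ≈⟨ refl⟩∘⟨ refl⟩∘⟨ refl⟩∘⟨ λ⇐-natural ⟩
      (id ⊗₁ φ) ∘ α⇒ ∘ (v ⊗₁ id) ∘ λ⇐ ∘ m ∎

    module _ (pm≈m : pairingMult ≈ m) where
      mult†≈rightMul : m † ≈ rightMul copairing
      mult†≈rightMul = begin
        m † ≈⟨ †-resp-≈ pm≈m ⟨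
        (ρ⇒ ∘ (id ⊗₁ pairing) ∘ α⇒ ∘ (m † ⊗₁ id)) † ≈⟨ †-∘₄ ⟩
        (m † ⊗₁ id) † ∘ α⇐ ∘ (id ⊗₁ pairing) † ∘ ρ⇐ ≈⟨ ≈.trans †⊗id (⊗id-resp-≈ †-involutive) ⟩∘⟨ refl⟩∘⟨ ≈.trans id⊗† (id⊗-resp-≈ pairing†) ⟩∘⟨ ≈.refl ⟩
        (m ⊗₁ id) ∘ α⇐ ∘ (id ⊗₁ copairing) ∘ ρ⇐ ∎

      pairing-snake : λ⇒ ∘ (pairing ⊗₁ id) ∘ α⇐ ∘ (id ⊗₁ copairing) ∘ ρ⇐ ≈ id
      pairing-snake = begin
        λ⇒ ∘ (pairing ⊗₁ id) ∘ α⇐ ∘ (id ⊗₁ copairing) ∘ ρ⇐ ≈⟨ refl⟩∘⟨ pushˡ (≈.sym ⊗id∘⊗id) ⟩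
        λ⇒ ∘ (eₘ † ⊗₁ id) ∘ (m ⊗₁ id) ∘ α⇐ ∘ (id ⊗₁ copairing) ∘ ρ⇐ ≈⟨ refl⟩∘⟨ refl⟩∘⟨ mult†≈rightMul ⟨
        λ⇒ ∘ (eₘ † ⊗₁ id) ∘ m † ≈⟨ refl⟩∘⟨ unit-left† ⟩
        λ⇒ ∘ λ⇐ ≈⟨ λ-unitaryʳ ⟩
        id ∎

      pairingMultˡ≈mult : λ⇒ ∘ (pairing ⊗₁ id) ∘ α⇐ ∘ (id ⊗₁ m †) ≈ m
      pairingMultˡ≈mult = begin
        λ⇒ ∘ (pairing ⊗₁ id) ∘ α⇐ ∘ (id ⊗₁ m †) ≈⟨ refl⟩∘⟨ refl⟩∘⟨ refl⟩∘⟨ id⊗-resp-≈ mult†≈rightMul ⟩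
        λ⇒ ∘ (pairing ⊗₁ id) ∘ α⇐ ∘ (id ⊗₁ rightMul copairing) ≈⟨ refl⟩∘⟨ rightMul-linear pairing-assoc ⟩
        λ⇒ ∘ (pairing ⊗₁ id) ∘ α⇐ ∘ (id ⊗₁ copairing) ∘ ρ⇐ ∘ m ≈⟨ assoc⁵ ⟨
        (λ⇒ ∘ (pairing ⊗₁ id) ∘ α⇐ ∘ (id ⊗₁ copairing) ∘ ρ⇐) ∘ m ≈⟨ elimˡ pairing-snake ⟩
        m ∎

      mult†≈leftMul : m † ≈ leftMul copairing
      mult†≈leftMul = begin
        m † ≈⟨ †-resp-≈ pairingMultˡ≈mult ⟨
        (λ⇒ ∘ (pairing ⊗₁ id) ∘ α⇐ ∘ (id ⊗₁ m †)) † ≈⟨ †-∘₄ ⟩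
        (id ⊗₁ m †) † ∘ α⇐ † ∘ (pairing ⊗₁ id) † ∘ λ⇐ ≈⟨ ≈.trans id⊗† (id⊗-resp-≈ †-involutive) ⟩∘⟨ †-involutive ⟩∘⟨ ≈.trans †⊗id (⊗id-resp-≈ pairing†) ⟩∘⟨ ≈.refl ⟩
        (id ⊗₁ m) ∘ α⇒ ∘ (copairing ⊗₁ id) ∘ λ⇐ ∎

      frobenius-from-pairingMult : IsFrobenius 𝒞 M
      frobenius-from-pairingMult = begin
        (id ⊗₁ m) ∘ α⇒ ∘ (m † ⊗₁ id) ≈⟨ refl⟩∘⟨ refl⟩∘⟨ ⊗id-resp-≈ mult†≈leftMul ⟩
        (id ⊗₁ m) ∘ α⇒ ∘ (leftMul copairing ⊗₁ id) ≈⟨ leftMul-linear mult-assoc ⟩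
        (id ⊗₁ m) ∘ α⇒ ∘ (copairing ⊗₁ id) ∘ λ⇐ ∘ m ≈⟨ assoc⁴ ⟨
        leftMul copairing ∘ m ≈⟨ mult†≈leftMul ⟩∘⟨refl ⟨
        m † ∘ m ≈⟨ mult†≈rightMul ⟩∘⟨refl ⟩
        rightMul copairing ∘ m ≈⟨ assoc⁴ ⟩
        (m ⊗₁ id) ∘ α⇐ ∘ (id ⊗₁ copairing) ∘ ρ⇐ ∘ m ≈⟨ rightMul-linear mult-assoc′ ⟨
        (m ⊗₁ id) ∘ α⇐ ∘ (id ⊗₁ rightMul copairing) ≈⟨ refl⟩∘⟨ refl⟩∘⟨ id⊗-resp-≈ mult†≈rightMul ⟨
        (m ⊗₁ id) ∘ α⇐ ∘ (id ⊗₁ m †) ∎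
  module Involutive {A : Obj} (M : Monoid 𝒞 A) where
    open Monoid M renaming (mult to m; unit to eₘ)
    open Frobenius M

    -- definitionally curry A pairing
    i : Hom A (A *)
    i = inv 𝒞 M

    uncurry-inv : uncurry A i ≈ pairing
    uncurry-inv = uncurry-curry

    R-unit : R 𝒞 M ∘ eₘ ≈ u A
    R-unit = begin
      ((id ⊗₁ m) ∘ α⇒ ∘ (u A ⊗₁ id) ∘ λ⇐) ∘ eₘ ≈⟨ assoc⁴ ⟩
      (id ⊗₁ m) ∘ α⇒ ∘ (u A ⊗₁ id) ∘ λ⇐ ∘ eₘ ≈⟨ refl⟩∘⟨ refl⟩∘⟨ refl⟩∘⟨ λ⇐-natural ⟨
      (id ⊗₁ m) ∘ α⇒ ∘ (u A ⊗₁ id) ∘ (id ⊗₁ eₘ) ∘ λ⇐ ≈⟨ refl⟩∘⟨ refl⟩∘⟨ extendʳ (≈.trans ⊗-interchange ((≈.sym ⊗-identity ⟩⊗⟨ ≈.refl) ⟩∘⟨refl)) ⟩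
      (id ⊗₁ m) ∘ α⇒ ∘ ((id ⊗₁ id) ⊗₁ eₘ) ∘ (u A ⊗₁ id) ∘ λ⇐ ≈⟨ refl⟩∘⟨ extendʳ α-natural ⟩
      (id ⊗₁ m) ∘ (id ⊗₁ (id ⊗₁ eₘ)) ∘ α⇒ ∘ (u A ⊗₁ id) ∘ λ⇐ ≈⟨ pullˡ (≈.trans id⊗∘id⊗ (id⊗-resp-≈ unit-right)) ⟩
      (id ⊗₁ ρ⇒) ∘ α⇒ ∘ (u A ⊗₁ id) ∘ λ⇐ ≈⟨ pullˡ kelly₂ ⟩
      ρ⇒ ∘ (u A ⊗₁ id) ∘ λ⇐ ≈⟨ extendʳ ρ-natural ⟩
      u A ∘ ρ⇒ ∘ λ⇐ ≈⟨ elimʳ (≈.trans (≈.sym kelly₃ ⟩∘⟨refl) λ-unitaryʳ) ⟩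
      u A ∎

    R-mult : R 𝒞 M ∘ m ≈ pantsMult 𝒞 A ∘ (R 𝒞 M ⊗₁ R 𝒞 M)
    R-mult = ≈.sym (begin
      pantsMult 𝒞 A ∘ (R 𝒞 M ⊗₁ R 𝒞 M) ≈⟨ refl⟩∘⟨ serialize₂₁ ⟩
      pantsMult 𝒞 A ∘ (id ⊗₁ R 𝒞 M) ∘ (R 𝒞 M ⊗₁ id) ≈⟨ pullˡ pantsMult∘id⊗ ⟩
      ((id ⊗₁ unbend A (R 𝒞 M)) ∘ α⇒) ∘ (R 𝒞 M ⊗₁ id) ≈⟨ (id⊗-resp-≈ unbend-bend ⟩∘⟨refl) ⟩∘⟨refl ⟩
      ((id ⊗₁ m) ∘ α⇒) ∘ (R 𝒞 M ⊗₁ id) ≈⟨ assoc ⟩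
      (id ⊗₁ m) ∘ α⇒ ∘ (R 𝒞 M ⊗₁ id) ≈⟨ leftMul-linear mult-assoc ⟩
      (id ⊗₁ m) ∘ α⇒ ∘ (u A ⊗₁ id) ∘ λ⇐ ∘ m ≈⟨ assoc⁴ ⟨
      R 𝒞 M ∘ m ∎)

    inv-unit : i ∘ eₘ ≈ opUnit 𝒞 M
    inv-unit = uncurry-injective (begin
      uncurry A (i ∘ eₘ) ≈⟨ uncurry-∘ ⟩
      uncurry A i ∘ (id ⊗₁ eₘ) ≈⟨ uncurry-inv ⟩∘⟨refl ⟩
      (eₘ † ∘ m) ∘ (id ⊗₁ eₘ) ≈⟨ ≈.trans assoc (refl⟩∘⟨ unit-right) ⟩
      eₘ † ∘ ρ⇒ ≈⟨ ρ-natural ⟨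
      ρ⇒ ∘ (eₘ † ⊗₁ id) ≈⟨ counit-I ⟩∘⟨refl ⟨
      (c I ∘ (id ⊗₁ cast 𝒞 (sym dual-I))) ∘ (eₘ † ⊗₁ id) ≈⟨ ≈.trans assoc (refl⟩∘⟨ ⊗-interchange˘) ⟩
      c I ∘ (eₘ † ⊗₁ id) ∘ (id ⊗₁ cast 𝒞 (sym dual-I)) ≈⟨ ≈.trans (uncurry-lower* ⟩∘⟨refl) assoc ⟨
      uncurry A (lower* 𝒞 eₘ) ∘ (id ⊗₁ cast 𝒞 (sym dual-I)) ≈⟨ uncurry-∘ ⟨
      uncurry A (opUnit 𝒞 M) ∎)

    nestedCounit∘inv⊗inv : nestedCounit A A ∘ (id ⊗₁ (i ⊗₁ i)) ≈ pairing ∘ (id ⊗₁ λ⇒) ∘ (id ⊗₁ (pairing ⊗₁ id)) ∘ (id ⊗₁ α⇐) ∘ α⇒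
    nestedCounit∘inv⊗inv = begin
      (c A ∘ (id ⊗₁ λ⇒) ∘ (id ⊗₁ (c A ⊗₁ id)) ∘ (id ⊗₁ α⇐) ∘ α⇒) ∘ (id ⊗₁ (i ⊗₁ i)) ≈⟨ assoc⁵ ⟩
      c A ∘ (id ⊗₁ λ⇒) ∘ (id ⊗₁ (c A ⊗₁ id)) ∘ (id ⊗₁ α⇐) ∘ α⇒ ∘ (id ⊗₁ (i ⊗₁ i))
        ≈⟨ refl⟩∘⟨ refl⟩∘⟨ refl⟩∘⟨ refl⟩∘⟨ refl⟩∘⟨ (⊗-identity ⟩⊗⟨ ≈.refl) ⟨
      c A ∘ (id ⊗₁ λ⇒) ∘ (id ⊗₁ (c A ⊗₁ id)) ∘ (id ⊗₁ α⇐) ∘ α⇒ ∘ ((id ⊗₁ id) ⊗₁ (i ⊗₁ i))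
        ≈⟨ refl⟩∘⟨ refl⟩∘⟨ refl⟩∘⟨ refl⟩∘⟨ α-natural ⟩
      c A ∘ (id ⊗₁ λ⇒) ∘ (id ⊗₁ (c A ⊗₁ id)) ∘ (id ⊗₁ α⇐) ∘ (id ⊗₁ (id ⊗₁ (i ⊗₁ i))) ∘ α⇒
        ≈⟨ refl⟩∘⟨ ≈.trans (id⊗-split₄ ⟩∘⟨refl) assoc⁴ ⟨
      c A ∘ (id ⊗₁ (λ⇒ ∘ (c A ⊗₁ id) ∘ α⇐ ∘ (id ⊗₁ (i ⊗₁ i)))) ∘ α⇒ ≈⟨ refl⟩∘⟨ id⊗-resp-≈ contract-i⊗i ⟩∘⟨refl ⟩
      c A ∘ (id ⊗₁ (i ∘ λ⇒ ∘ (pairing ⊗₁ id) ∘ α⇐)) ∘ α⇒ ≈⟨ refl⟩∘⟨ pushˡ id⊗-split ⟩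
      c A ∘ (id ⊗₁ i) ∘ (id ⊗₁ (λ⇒ ∘ (pairing ⊗₁ id) ∘ α⇐)) ∘ α⇒ ≈⟨ pullˡ uncurry-inv ⟩
      pairing ∘ (id ⊗₁ (λ⇒ ∘ (pairing ⊗₁ id) ∘ α⇐)) ∘ α⇒ ≈⟨ refl⟩∘⟨ ≈.trans (id⊗-split₃ ⟩∘⟨refl) (≈.trans assoc (refl⟩∘⟨ assoc)) ⟩
      pairing ∘ (id ⊗₁ λ⇒) ∘ (id ⊗₁ (pairing ⊗₁ id)) ∘ (id ⊗₁ α⇐) ∘ α⇒ ∎
      where
        contract-i⊗i : λ⇒ ∘ (c A ⊗₁ id) ∘ α⇐ ∘ (id ⊗₁ (i ⊗₁ i)) ≈ i ∘ λ⇒ ∘ (pairing ⊗₁ id) ∘ α⇐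
        contract-i⊗i = begin
          λ⇒ ∘ (c A ⊗₁ id) ∘ α⇐ ∘ (id ⊗₁ (i ⊗₁ i)) ≈⟨ refl⟩∘⟨ refl⟩∘⟨ α⇐-natural ⟩
          λ⇒ ∘ (c A ⊗₁ id) ∘ ((id ⊗₁ i) ⊗₁ i) ∘ α⇐ ≈⟨ refl⟩∘⟨ pullˡ ⊗∘⊗ ⟩
          λ⇒ ∘ ((c A ∘ (id ⊗₁ i)) ⊗₁ (id ∘ i)) ∘ α⇐ ≈⟨ refl⟩∘⟨ (uncurry-inv ⟩⊗⟨ identityˡ) ⟩∘⟨refl ⟩
          λ⇒ ∘ (pairing ⊗₁ i) ∘ α⇐ ≈⟨ refl⟩∘⟨ pushˡ serialize₂₁ ⟩
          λ⇒ ∘ (id ⊗₁ i) ∘ (pairing ⊗₁ id) ∘ α⇐ ≈⟨ extendʳ λ-natural ⟩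
          i ∘ λ⇒ ∘ (pairing ⊗₁ id) ∘ α⇐ ∎

    inv-mult : pairingMult ≈ m → i ∘ m ≈ opMult 𝒞 M ∘ (i ⊗₁ i)
    inv-mult pm≈m = uncurry-injective (begin
      uncurry A (i ∘ m) ≈⟨ uncurry-∘ ⟩
      uncurry A i ∘ (id ⊗₁ m) ≈⟨ uncurry-inv ⟩∘⟨refl ⟩
      pairing ∘ (id ⊗₁ m) ≈⟨ pairing-assoc ⟩
      pairing ∘ (m ⊗₁ id) ∘ α⇐ ≈⟨ refl⟩∘⟨ ⊗id-resp-≈ pm≈m ⟩∘⟨refl ⟨
      pairing ∘ (pairingMult ⊗₁ id) ∘ α⇐ ≈⟨ refl⟩∘⟨ contraction-assoc ⟨
      pairing ∘ (id ⊗₁ λ⇒) ∘ (id ⊗₁ (pairing ⊗₁ id)) ∘ (id ⊗₁ α⇐) ∘ α⇒ ∘ (m † ⊗₁ id) ≈⟨ assoc⁵ ⟨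
      (pairing ∘ (id ⊗₁ λ⇒) ∘ (id ⊗₁ (pairing ⊗₁ id)) ∘ (id ⊗₁ α⇐) ∘ α⇒) ∘ (m † ⊗₁ id) ≈⟨ nestedCounit∘inv⊗inv ⟩∘⟨refl ⟨
      (nestedCounit A A ∘ (id ⊗₁ (i ⊗₁ i))) ∘ (m † ⊗₁ id) ≈⟨ ≈.trans assoc (refl⟩∘⟨ ⊗-interchange˘) ⟩
      nestedCounit A A ∘ (m † ⊗₁ id) ∘ (id ⊗₁ (i ⊗₁ i)) ≈⟨ counit-⊗≈nestedCounit A A ⟩∘⟨refl ⟨
      uncurry (A ⊗₀ A) (cast 𝒞 (sym (dual-⊗ A A))) ∘ (m † ⊗₁ id) ∘ (id ⊗₁ (i ⊗₁ i)) ≈⟨ ≈.trans assoc (refl⟩∘⟨ pullˡ ⊗-interchange˘) ⟩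
      c (A ⊗₀ A) ∘ ((m † ⊗₁ id) ∘ (id ⊗₁ cast 𝒞 (sym (dual-⊗ A A)))) ∘ (id ⊗₁ (i ⊗₁ i)) ≈⟨ sym-assoc ⟩
      (c (A ⊗₀ A) ∘ (m † ⊗₁ id) ∘ (id ⊗₁ cast 𝒞 (sym (dual-⊗ A A)))) ∘ (id ⊗₁ (i ⊗₁ i)) ≈⟨ ≈.trans (uncurry-∘ ⟩∘⟨refl) (≈.trans ((uncurry-lower* ⟩∘⟨refl) ⟩∘⟨refl) (assoc ⟩∘⟨refl)) ⟨
      uncurry A (lower* 𝒞 m ∘ cast 𝒞 (sym (dual-⊗ A A))) ∘ (id ⊗₁ (i ⊗₁ i)) ≈⟨ uncurry-∘ ⟨
      uncurry A (opMult 𝒞 M ∘ (i ⊗₁ i)) ∎)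

    inv⊗id∘copairing : pairingMult ≈ m → (i ⊗₁ id) ∘ copairing ≈ u A
    inv⊗id∘copairing pm≈m = begin
      (i ⊗₁ id) ∘ copairing ≈⟨ curry⊗id-∘ ⟩
      (id ⊗₁ (λ⇒ ∘ (pairing ⊗₁ id) ∘ α⇐ ∘ (id ⊗₁ copairing) ∘ ρ⇐)) ∘ u A ≈⟨ elimˡ (≈.trans (id⊗-resp-≈ (pairing-snake pm≈m)) ⊗-identity) ⟩
      u A ∎

    inv-involutive : pairingMult ≈ m → cast 𝒞 (dual-involutive A) ∘ (lower* 𝒞 i ∘ i) ≈ id
    inv-involutive pm≈m = begin
      cast 𝒞 P ∘ (lower* 𝒞 i ∘ i) ≈⟨ refl⟩∘⟨ lower*i∘i≈cast ⟩
      cast 𝒞 P ∘ cast 𝒞 (sym P) ≈⟨ cast∘cast-sym P ⟩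
      id ∎
      where
        P : (A *) * ≡ A
        P = dual-involutive A
        lower*i∘i≈cast : lower* 𝒞 i ∘ i ≈ cast 𝒞 (sym P)
        lower*i∘i≈cast = uncurry-injective (begin
          uncurry (A *) (lower* 𝒞 i ∘ i) ≈⟨ uncurry-∘ ⟩
          uncurry (A *) (lower* 𝒞 i) ∘ (id ⊗₁ i) ≈⟨ uncurry-lower* ⟩∘⟨refl ⟩
          (c A ∘ (i † ⊗₁ id)) ∘ (id ⊗₁ i) ≈⟨ ≈.trans assoc (refl⟩∘⟨ ⊗-interchange) ⟩
          c A ∘ (id ⊗₁ i) ∘ (i † ⊗₁ id) ≈⟨ pullˡ uncurry-inv ⟩
          pairing ∘ (i † ⊗₁ id) ≈⟨ copairing† ⟩∘⟨ †⊗id ⟨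
          copairing † ∘ (i ⊗₁ id) † ≈⟨ †-homomorphism ⟨
          ((i ⊗₁ id) ∘ copairing) † ≈⟨ †-resp-≈ (inv⊗id∘copairing pm≈m) ⟩
          u A † ≈⟨ counit-dual A ⟨
          uncurry (A *) (cast 𝒞 (sym P)) ∎)

    R† : R 𝒞 M † ≈ λ⇒ ∘ (u A † ⊗₁ id) ∘ α⇐ ∘ (id ⊗₁ m †)
    R† = ≈.trans †-∘₄ (†-involutive ⟩∘⟨ †⊗id ⟩∘⟨ ≈.refl ⟩∘⟨ id⊗†)

    uncurry-lower*R∘inv : uncurry (A * ⊗₀ A) (lower* 𝒞 (R 𝒞 M) ∘ i) ≈ u A † ∘ (id ⊗₁ pairingMult) ∘ α⇒
    uncurry-lower*R∘inv = begin
      uncurry (A * ⊗₀ A) (lower* 𝒞 (R 𝒞 M) ∘ i) ≈⟨ uncurry-∘ ⟩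
      uncurry (A * ⊗₀ A) (lower* 𝒞 (R 𝒞 M)) ∘ (id ⊗₁ i) ≈⟨ uncurry-lower* ⟩∘⟨refl ⟩
      (c A ∘ (R 𝒞 M † ⊗₁ id)) ∘ (id ⊗₁ i) ≈⟨ ≈.trans assoc (refl⟩∘⟨ ⊗-interchange) ⟩
      c A ∘ (id ⊗₁ i) ∘ (R 𝒞 M † ⊗₁ id) ≈⟨ pullˡ uncurry-inv ⟩
      pairing ∘ (R 𝒞 M † ⊗₁ id) ≈⟨ refl⟩∘⟨ ⊗id-resp-≈ R† ⟩
      pairing ∘ ((λ⇒ ∘ (u A † ⊗₁ id) ∘ α⇐ ∘ (id ⊗₁ m †)) ⊗₁ id) ≈⟨ contraction-exchange ⟩
      u A † ∘ (id ⊗₁ pairingMult) ∘ α⇒ ∎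

    uncurry-pantsInv∘R : uncurry (A * ⊗₀ A) (pantsInv 𝒞 A ∘ R 𝒞 M) ≈ u A † ∘ (id ⊗₁ m) ∘ α⇒
    uncurry-pantsInv∘R = begin
      uncurry (A * ⊗₀ A) (pantsInv 𝒞 A ∘ R 𝒞 M) ≈⟨ uncurry-∘ ⟩
      uncurry (A * ⊗₀ A) (pantsInv 𝒞 A) ∘ (id ⊗₁ R 𝒞 M) ≈⟨ uncurry-pantsInv ⟩∘⟨refl ⟩
      (u A † ∘ (id ⊗₁ (λ⇒ ∘ (c A ⊗₁ id) ∘ α⇐)) ∘ α⇒) ∘ (id ⊗₁ R 𝒞 M) ≈⟨ ≈.trans assoc (refl⟩∘⟨ assoc) ⟩
      u A † ∘ (id ⊗₁ (λ⇒ ∘ (c A ⊗₁ id) ∘ α⇐)) ∘ α⇒ ∘ (id ⊗₁ R 𝒞 M)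
        ≈⟨ refl⟩∘⟨ refl⟩∘⟨ refl⟩∘⟨ (⊗-identity ⟩⊗⟨ ≈.refl) ⟨
      u A † ∘ (id ⊗₁ (λ⇒ ∘ (c A ⊗₁ id) ∘ α⇐)) ∘ α⇒ ∘ ((id ⊗₁ id) ⊗₁ R 𝒞 M) ≈⟨ refl⟩∘⟨ refl⟩∘⟨ α-natural ⟩
      u A † ∘ (id ⊗₁ (λ⇒ ∘ (c A ⊗₁ id) ∘ α⇐)) ∘ (id ⊗₁ (id ⊗₁ R 𝒞 M)) ∘ α⇒ ≈⟨ refl⟩∘⟨ pullˡ id⊗∘id⊗ ⟩
      u A † ∘ (id ⊗₁ ((λ⇒ ∘ (c A ⊗₁ id) ∘ α⇐) ∘ (id ⊗₁ R 𝒞 M))) ∘ α⇒ ≈⟨ refl⟩∘⟨ id⊗-resp-≈ (≈.trans assoc (refl⟩∘⟨ assoc)) ⟩∘⟨refl ⟩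
      u A † ∘ (id ⊗₁ unbend A (R 𝒞 M)) ∘ α⇒ ≈⟨ refl⟩∘⟨ id⊗-resp-≈ unbend-bend ⟩∘⟨refl ⟩
      u A † ∘ (id ⊗₁ m) ∘ α⇒ ∎

    R-involutive : pairingMult ≈ m → pantsInv 𝒞 A ∘ R 𝒞 M ≈ lower* 𝒞 (R 𝒞 M) ∘ i
    R-involutive pm≈m = uncurry-injective (begin
      uncurry (A * ⊗₀ A) (pantsInv 𝒞 A ∘ R 𝒞 M) ≈⟨ uncurry-pantsInv∘R ⟩
      u A † ∘ (id ⊗₁ m) ∘ α⇒ ≈⟨ refl⟩∘⟨ id⊗-resp-≈ pm≈m ⟩∘⟨refl ⟨
      u A † ∘ (id ⊗₁ pairingMult) ∘ α⇒ ≈⟨ uncurry-lower*R∘inv ⟨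
      uncurry (A * ⊗₀ A) (lower* 𝒞 (R 𝒞 M) ∘ i) ∎)

    pairingMult-from-R-involutive : pantsInv 𝒞 A ∘ R 𝒞 M ≈ lower* 𝒞 (R 𝒞 M) ∘ i → pairingMult ≈ m
    pairingMult-from-R-involutive R-inv = ≈.sym (u†∘id⊗-injective (cancel-split-epi α-unitaryʳ (begin
      (u A † ∘ (id ⊗₁ m)) ∘ α⇒ ≈⟨ assoc ⟩
      u A † ∘ (id ⊗₁ m) ∘ α⇒ ≈⟨ uncurry-pantsInv∘R ⟨
      uncurry (A * ⊗₀ A) (pantsInv 𝒞 A ∘ R 𝒞 M) ≈⟨ uncurry-resp-≈ R-inv ⟩
      uncurry (A * ⊗₀ A) (lower* 𝒞 (R 𝒞 M) ∘ i) ≈⟨ uncurry-lower*R∘inv ⟩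
      u A † ∘ (id ⊗₁ pairingMult) ∘ α⇒ ≈⟨ sym-assoc ⟩
      (u A † ∘ (id ⊗₁ pairingMult)) ∘ α⇒ ∎)))

theorem3p8 : {o ℓ e : Level} (𝒞 : CompactDaggerCategory o ℓ e)
             {A : CompactDaggerCategory.Obj 𝒞} (M : Monoid 𝒞 A) →
             IsFrobenius 𝒞 M
               ⇔ (IsInvolution 𝒞 M (inv 𝒞 M)
                  × IsInvolutiveMonoidHom 𝒞
                      (Monoid.mult M) (Monoid.unit M) (inv 𝒞 M)
                      (pantsMult 𝒞 A) (pantsUnit 𝒞 A) (pantsInv 𝒞 A)
                      (R 𝒞 M))
theorem3p8 𝒞 M = mk⇔
  (λ frobenius → let pm≈m = pairingMult≈mult frobenius in
    ((inv-mult pm≈m , inv-unit) , inv-involutive pm≈m) , (R-mult , R-unit) , R-involutive pm≈m)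
  (λ (_ , _ , R-inv) → frobenius-from-pairingMult (pairingMult-from-R-involutive R-inv))
  where
    open Calculus 𝒞
    open Frobenius M
    open Involutive M
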